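{- Let $k\ge 2$ and let $x_1,\ldots,x_k,y_1,\ldots,y_k$ be real numbers. For each nonempty $I\subseteq\{2,\ldots,k\}$ put $x_I=x_1+\sum_{i\in I}x_i$ and $y_I=y_1+\sum_{i\in I}y_i$, and let $\{i_1,\ldots,i_r\}=\{2,\ldots,k\}\setminus I$, where $r=k-1-|I|$. Then $$\phi(x_1,y_1,x_2,y_2,\ldots,x_k,y_k)=\sum_{\emptyset\ne I\subseteq \{2,\ldots,k\}}\left((-1)^{|I|-1}\left(\prod_{j\in I}(x_1y_j+x_jy_1)\right)\phi(x_I,y_I,x_{i_1},y_{i_1},\ldots,x_{i_r},y_{i_r})\right).$$
   Context: For every $\ell\ge 1$, $\phi$ is the function of $2\ell$ variables $x_1,y_1,\ldots,x_\ell,y_\ell$ given by $$\phi(x_1,y_1,\ldots,x_\ell,y_\ell)=\frac{1}{XY}\left(\prod_{i=1}^\ell(x_iY+y_iX)\right)\left(1-\sum_{i=1}^\ell\frac{x_iy_i}{x_iY+y_iX}\right)=\frac{1}{XY}\left(\prod_{i=1}^\ell(x_iY+y_iX)-\sum_{i=1}^\ell x_iy_i\prod_{j\ne i}(x_jY+y_jX)\right),$$ where $X=x_1+\cdots+x_\ell$ and $Y=y_1+\cdots+y_\ell$. This expression is a polynomial in the $2\ell$ variables (e.g. $\phi(x_1,y_1)=1$, $\phi(x_1,y_1,x_2,y_2)=x_1y_2+x_2y_1$), and for real arguments $\phi$ denotes the value of this polynomial. -}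

module Defs where

open import Level using (Level)
open import Algebra.Bundles using (CommutativeRing)
open import Data.Nat using (ℕ; zero; suc; _∸_)
open import Data.Fin using (Fin; zero; suc; _≟_)
open import Data.Fin.Subset using (Subset; inside; outside; ∣_∣; Nonempty)
open import Data.Fin.Subset.Properties using (nonempty?)
open import Data.Vec using (Vec; []; _∷_) renaming (lookup to vlookup)
open import Data.List using (List; []; _∷_; _++_; map; foldr; filter; length; lookup)
open import Data.Product using (_×_; _,_; proj₁; proj₂)
open import Data.Bool using (if_then_else_)
open import Relation.Nullary using (does)

allSubsets : ∀ n → List (Subset n)
allSubsets zero    = [] ∷ []
allSubsets (suc n) = map (inside ∷_) (allSubsets n) ++ map (outside ∷_) (allSubsets n)

module _ {c ℓ : Level} (R : CommutativeRing c ℓ) where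
  open CommutativeRing R using (Carrier; _+_; _*_; -_; _-_; 0#; 1#)

  Σᶠ : ∀ {n} → (Fin n → Carrier) → Carrier
  Σᶠ {zero}  f = 0#
  Σᶠ {suc n} f = f zero + Σᶠ (λ i → f (suc i))

  Πᶠ : ∀ {n} → (Fin n → Carrier) → Carrier
  Πᶠ {zero}  f = 1#
  Πᶠ {suc n} f = f zero * Πᶠ (λ i → f (suc i))

  sumL : List Carrier → Carrier
  sumL = foldr _+_ 0#

  negOnePow : ℕ → Carrier
  negOnePow zero    = 1#
  negOnePow (suc n) = - negOnePow n

  -- Univariate polynomials over R in an indeterminate t,
  -- coefficient lists from the constant term upwards.
  Poly : Set c
  Poly = List Carrier

  _⊕_ : Poly → Poly → Poly
  []       ⊕ q        = q
  (a ∷ p)  ⊕ []       = a ∷ p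
  (a ∷ p)  ⊕ (b ∷ q)  = (a + b) ∷ (p ⊕ q)

  scale : Carrier → Poly → Poly
  scale a = map (a *_)

  _⊗_ : Poly → Poly → Poly
  []      ⊗ q = []
  (a ∷ p) ⊗ q = scale a q ⊕ (0# ∷ (p ⊗ q))

  ⊖_ : Poly → Poly
  ⊖_ = map (λ a → - a)

  const : Carrier → Poly
  const a = a ∷ []

  tvar : Poly
  tvar = 0# ∷ 1# ∷ []

  evalP : Poly → Carrier → Carrier
  evalP p a = foldr (λ b acc → b + a * acc) 0# p

  ΣP : ∀ {n} → (Fin n → Poly) → Poly
  ΣP {zero}  f = []
  ΣP {suc n} f = f zero ⊕ ΣP (λ i → f (suc i))

  ΠP : ∀ {n} → (Fin n → Poly) → Poly
  ΠP {zero}  f = const 1#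
  ΠP {suc n} f = f zero ⊗ ΠP (λ i → f (suc i))

  -- Division by the monic linear polynomial (t + a): returns (quotient , remainder).
  -- If p = a₀ + t·p' and p' = (t + a) q' + r', then p = (t + a)(r' + t q') + (a₀ - a r').
  divLin : Poly → Carrier → Poly × Carrier
  divLin []       a = [] , 0#
  divLin (a₀ ∷ p) a with divLin p a
  ... | q' , r' = (r' ∷ q') , (a₀ - a * r')

  -- Numerator  N = ∏ᵢ (xᵢY + yᵢX) − Σᵢ xᵢyᵢ ∏_{j≠i} (xⱼY + yⱼX)  (X = Σ xᵢ, Y = Σ yᵢ)
  -- is divisible by XY as an integer polynomial, and φ = N / (XY).
  -- To evaluate this polynomial quotient at arbitrary ring elements (where XY may
  -- vanish), we specialise every variable except one indeterminate t:
  --   x₀ ↦ t,  y₀ ↦ t + (y₀ − x₀),  all other variables ↦ their values.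
  -- Then X ↦ t + cX and Y ↦ t + cY are monic linear in t, the exact quotient
  -- N/(XY) specialises to the exact quotient in R[t], computed by two synthetic
  -- divisions, and evaluating it at t = x₀ gives φ(x, y).
  φ : ∀ {m} → (Fin (suc m) → Carrier) → (Fin (suc m) → Carrier) → Carrier
  φ {m} x y = evalP quot (x zero)
    where
      e : Carrier
      e = y zero - x zero
      xt : Fin (suc m) → Poly
      xt zero    = tvar
      xt (suc i) = const (x (suc i))
      yt : Fin (suc m) → Poly
      yt zero    = tvar ⊕ const e
      yt (suc i) = const (y (suc i))
      Xt Yt : Poly
      Xt = ΣP xt
      Yt = ΣP yt
      cX cY : Carrier
      cX = Σᶠ (λ i → x (suc i))
      cY = e + Σᶠ (λ i → y (suc i))
      fac : Fin (suc m) → Poly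
      fac i = (xt i ⊗ Yt) ⊕ (yt i ⊗ Xt)
      N : Poly
      N = ΠP fac ⊕ (⊖ ΣP (λ i → (xt i ⊗ yt i) ⊗ ΠP (λ j → if does (i ≟ j) then const 1# else fac j)))
      quot : Poly
      quot = proj₁ (divLin (proj₁ (divLin N cX)) cY)

  -- Right-hand side of Theorem 3.1, for k = suc (suc n).
  -- Paper index 1 is Fin zero; paper indices 2..k are suc j for j : Fin (suc n),
  -- so a subset I ⊆ {2,…,k} is a Subset (suc n).
  module _ {n : ℕ} (x y : Fin (suc (suc n)) → Carrier) where

    xSub ySub : Subset (suc n) → Carrier
    xSub I = x zero + Σᶠ (λ j → if vlookup I j then x (suc j) else 0#)
    ySub I = y zero + Σᶠ (λ j → if vlookup I j then y (suc j) else 0#)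

    complPairs : ∀ {m} → Subset m → (Fin m → Carrier) → (Fin m → Carrier) → List (Carrier × Carrier)
    complPairs []             f g = []
    complPairs (inside  ∷ I) f g = complPairs I (λ j → f (suc j)) (λ j → g (suc j))
    complPairs (outside ∷ I) f g = (f zero , g zero) ∷ complPairs I (λ j → f (suc j)) (λ j → g (suc j))

    rest : Subset (suc n) → List (Carrier × Carrier)
    rest I = complPairs I (λ j → x (suc j)) (λ j → y (suc j))

    argX argY : (I : Subset (suc n)) → Fin (suc (length (rest I))) → Carrier
    argX I zero    = xSub I
    argX I (suc j) = proj₁ (lookup (rest I) j)
    argY I zero    = ySub I
    argY I (suc j) = proj₂ (lookup (rest I) j)

    term : Subset (suc n) → Carrier
    term I = negOnePow (∣ I ∣ ∸ 1)
             * (Πᶠ (λ j → if vlookup I j then (x zero * y (suc j) + x (suc j) * y zero) else 1#)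
             * φ (argX I) (argY I))

    rhs : Carrier
    rhs = sumL (map term (filter nonempty? (allSubsets (suc n))))

-- Write X = Σ xᵢ and Y = Σ yᵢ. For a list L of pairs (xⱼ, yⱼ) with weights wⱼ = xⱼY + yⱼX put
-- Φ = π − 2σ − τ, where π = ∏ wⱼ, σ = Σᵢ xᵢyᵢ ∏_{j≠i} wⱼ and τ = Σ_{i<j} (xᵢyⱼ − xⱼyᵢ)² ∏_{k≠i,j} wₖ.
-- When L consists of the pairs with index 2, …, k, the numerator of φ equals Φ·XY; when X and Y are
-- the sums over L itself, Φ·XY = 0.
-- To cancel XY in an arbitrary commutative ring we pass to a generic point: x₁ becomes an indeterminate t
-- and y₁ becomes t + (y₁ − x₁), so X = t + a and Y = t + b, and we compute in R[t]/((t + a)(t + b)(t − x₁)),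
-- where the top Newton coefficient of z·XY is the value of z at t = x₁. Hence φ = Φ(X, Y, L), and
-- Φ(Σ_L x, Σ_L y, L) = 0 for nonempty L.
-- Merging the indices of I into index 1 keeps X and Y, so the I-th term on the right is
-- ±(∏_{j∈I} cⱼ)·Φ(X, Y, L ∖ I) with cⱼ = x₁yⱼ + xⱼy₁. Lowering each weight wⱼ by cⱼ is the same as
-- replacing (X, Y) by (X − x₁, Y − y₁), the sums over L; since Φ is built one weight at a time,
-- inclusion–exclusion turns the alternating sum over all I into Φ(X − x₁, Y − y₁, L) = 0, and only
-- the term I = ∅, which is φ, survives.

module Submission where

open import Defs
open import Level using (0ℓ)
open import Algebra.Bundles using (CommutativeRing; AbelianGroup; Magma)
open import Algebra.Bundles.Raw using (RawRing)
open import Algebra.Structures using (IsCommutativeRing)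
open import Algebra.Consequences.Setoid using (comm∧idˡ⇒idʳ; comm∧distrˡ⇒distrʳ)
open import Algebra.Morphism.Structures using (IsRingHomomorphism)
import Algebra.Morphism.Construct.Identity as Identity
import Algebra.Construct.DirectProduct as DirectProduct
open import Algebra.Module.Bundles using (LeftSemimodule)
open import Algebra.Module.Construct.DirectProduct using (leftSemimodule)
import Algebra.Module.Construct.TensorUnit as TensorUnit
open import Algebra.Solver.Ring.AlmostCommutativeRing
  using (fromCommutativeRing; _-Raw-AlmostCommutative⟶_; Induced-equivalence)
open import Data.Bool.Base using (Bool; true; false; if_then_else_)
open import Data.Fin using (Fin; #_; _≟_)
open import Data.Fin.Base using (zero; suc)
open import Data.Fin.Subset using (Subset; inside; outside; ∣_∣; ⊥)
open import Data.Fin.Subset.Properties using (nonempty?)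
open import Data.Integer.Base using (+_)
open import Data.List.Base using (List; []; _∷_; _++_; foldr; map; filter; tabulate; lookup)
open import Data.List.Properties using (tabulate-lookup; map-++; map-∘)
open import Data.List.Relation.Binary.Pointwise.Base using (Pointwise; []; _∷_)
open import Data.List.Relation.Binary.Pointwise using (tabulate⁺) renaming (refl to Pointwise-refl)
open import Data.Maybe.Base using (just; nothing)
open import Data.Nat.Base as ℕ using (ℕ; suc; zero; z≤n; _∸_)
import Data.Nat.Properties as ℕ
open import Data.Product.Base using (_×_; _,_; proj₁; proj₂)
open import Data.Vec.Base using (Vec; []; _∷_; there) renaming (lookup to vlookup)
open import Function.Base using (_∘_)
open import Function.Bundles using (mk⇔)
open import Relation.Binary.Definitions using (WeaklyDecidable)
open import Relation.Binary.PropositionalEquality using (_≡_; cong; cong₂) renaming (refl to ≡-refl)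
open import Relation.Nullary using (Dec; does; yes; no)
open import Relation.Nullary.Decidable using (does-⇔)

module IntegerCoefficients {c ℓ} (R : CommutativeRing c ℓ) where
  open import Data.Integer.Base as ℤ using (ℤ; -[1+_]; _⊖_; _◃_; sign)
  import Data.Integer.Properties as ℤ
  open import Data.Sign.Base as Sign using (Sign)
  open CommutativeRing R hiding (zero)
  -- The type-checking-optimised multiple satisfies 0 ×′ 1# = 0# and 1 ×′ 1# = 1# definitionally, so
  -- the solver constants con (+ 0) and con (+ 1) evaluate to 0# and 1#.
  open import Algebra.Properties.Semiring.Mult.TCOptimised semiring using (1+×; ×-homo-+; ×1-homo-*)
    renaming (_×_ to _×′_)
  open import Algebra.Properties.Ring ring using (-1*x≈-x; -0#≈0#; -‿involutive)
  open import Algebra.Properties.AbelianGroup +-abelianGroup using (⁻¹-∙-comm)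
  open import Algebra.Properties.CommutativeSemigroup +-commutativeSemigroup
    using () renaming (interchange to +-interchange)
  open import Algebra.Properties.CommutativeSemigroup *-commutativeSemigroup
    using () renaming (interchange to *-interchange)
  open import Relation.Binary.Reasoning.Setoid setoid

  fromℤ : ℤ → Carrier
  fromℤ (+ n)    = n ×′ 1#
  fromℤ -[1+ n ] = - (suc n ×′ 1#)

  fromℤ-⊖ : ∀ m n → fromℤ (m ⊖ n) ≈ m ×′ 1# - n ×′ 1#
  fromℤ-⊖ m       zero    rewrite ℤ.⊖-≥ (z≤n {m}) = sym (trans (+-congˡ -0#≈0#) (+-identityʳ _))
  fromℤ-⊖ zero    (suc n) = sym (+-identityˡ _)
  fromℤ-⊖ (suc m) (suc n) rewrite ℤ.[1+m]⊖[1+n]≡m⊖n m n = begin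
    fromℤ (m ⊖ n)                        ≈⟨ fromℤ-⊖ m n ⟩
    m ×′ 1# - n ×′ 1#                    ≈⟨ +-identityˡ _ ⟨
    0# + (m ×′ 1# - n ×′ 1#)             ≈⟨ +-congʳ (-‿inverseʳ 1#) ⟨
    (1# - 1#) + (m ×′ 1# - n ×′ 1#)      ≈⟨ +-interchange 1# (- 1#) (m ×′ 1#) (- (n ×′ 1#)) ⟩
    (1# + m ×′ 1#) + (- 1# - n ×′ 1#)    ≈⟨ +-cong (1+× m 1#) (trans (-‿cong (1+× n 1#)) (sym (⁻¹-∙-comm _ _))) ⟨
    suc m ×′ 1# - suc n ×′ 1#            ∎

  fromℤ-+ : ∀ i j → fromℤ (i ℤ.+ j) ≈ fromℤ i + fromℤ j
  fromℤ-+ (+ m)    (+ n)    = ×-homo-+ 1# m n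
  fromℤ-+ (+ m)    -[1+ n ] = fromℤ-⊖ m (suc n)
  fromℤ-+ -[1+ m ] (+ n)    = trans (fromℤ-⊖ n (suc m)) (+-comm _ _)
  fromℤ-+ -[1+ m ] -[1+ n ] = begin
    - (suc (suc (m ℕ.+ n)) ×′ 1#)       ≡⟨ cong (λ k → - (suc k ×′ 1#)) (ℕ.+-suc m n) ⟨
    - ((suc m ℕ.+ suc n) ×′ 1#)         ≈⟨ -‿cong (×-homo-+ 1# (suc m) (suc n)) ⟩
    - (suc m ×′ 1# + suc n ×′ 1#)       ≈⟨ ⁻¹-∙-comm _ _ ⟨
    - (suc m ×′ 1#) + - (suc n ×′ 1#)   ∎

  sgn : Sign → Carrier
  sgn Sign.+ = 1#
  sgn Sign.- = - 1#

  sgn-* : ∀ s t → sgn (s Sign.* t) ≈ sgn s * sgn t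
  sgn-* Sign.+ t      = sym (*-identityˡ _)
  sgn-* Sign.- Sign.+ = sym (*-identityʳ _)
  sgn-* Sign.- Sign.- = sym (trans (-1*x≈-x (- 1#)) (-‿involutive 1#))

  fromℤ-◃ : ∀ s n → fromℤ (s ◃ n) ≈ sgn s * (n ×′ 1#)
  fromℤ-◃ s      zero    = sym (zeroʳ _)
  fromℤ-◃ Sign.+ (suc n) = sym (*-identityˡ _)
  fromℤ-◃ Sign.- (suc n) = sym (-1*x≈-x _)

  fromℤ-sign-abs : ∀ i → fromℤ i ≈ sgn (sign i) * (ℤ.∣ i ∣ ×′ 1#)
  fromℤ-sign-abs i = begin
    fromℤ i                         ≡⟨ cong fromℤ (ℤ.◃-inverse i) ⟨
    fromℤ (sign i ◃ ℤ.∣ i ∣)        ≈⟨ fromℤ-◃ (sign i) ℤ.∣ i ∣ ⟩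
    sgn (sign i) * (ℤ.∣ i ∣ ×′ 1#)  ∎

  fromℤ-* : ∀ i j → fromℤ (i ℤ.* j) ≈ fromℤ i * fromℤ j
  fromℤ-* i j = begin
    fromℤ ((sign i Sign.* sign j) ◃ (ℤ.∣ i ∣ ℕ.* ℤ.∣ j ∣))
      ≈⟨ fromℤ-◃ (sign i Sign.* sign j) (ℤ.∣ i ∣ ℕ.* ℤ.∣ j ∣) ⟩
    sgn (sign i Sign.* sign j) * ((ℤ.∣ i ∣ ℕ.* ℤ.∣ j ∣) ×′ 1#)
      ≈⟨ *-cong (sgn-* (sign i) (sign j)) (×1-homo-* ℤ.∣ i ∣ ℤ.∣ j ∣) ⟩
    (sgn (sign i) * sgn (sign j)) * ((ℤ.∣ i ∣ ×′ 1#) * (ℤ.∣ j ∣ ×′ 1#))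
      ≈⟨ *-interchange _ _ _ _ ⟩
    (sgn (sign i) * (ℤ.∣ i ∣ ×′ 1#)) * (sgn (sign j) * (ℤ.∣ j ∣ ×′ 1#))
      ≈⟨ *-cong (fromℤ-sign-abs i) (fromℤ-sign-abs j) ⟨
    fromℤ i * fromℤ j
      ∎

  fromℤ-neg : ∀ i → fromℤ (ℤ.- i) ≈ - fromℤ i
  fromℤ-neg (+ zero)  = sym -0#≈0#
  fromℤ-neg (+ suc n) = refl
  fromℤ-neg -[1+ n ]  = sym (-‿involutive _)

  fromℤ-morphism : ℤ.+-*-rawRing -Raw-AlmostCommutative⟶ fromCommutativeRing R
  fromℤ-morphism = record
    { ⟦_⟧ = fromℤ ; +-homo = fromℤ-+ ; *-homo = fromℤ-* ; -‿homo = fromℤ-neg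
    ; 0-homo = refl ; 1-homo = refl }

  fromℤ-≟ : WeaklyDecidable (Induced-equivalence fromℤ-morphism)
  fromℤ-≟ i j with i ℤ.≟ j
  ... | yes ≡-refl = just refl
  ... | no _       = nothing

  open import Algebra.Solver.Ring ℤ.+-*-rawRing (fromCommutativeRing R) fromℤ-morphism fromℤ-≟ public
    using (solve; prove; _:=_; _:+_; _:*_; _:-_; :-_; con; var; Polynomial; ⟦_⟧; ⟦_⟧↓)

  -- The ring formulas below are written once over a raw ring;
  -- instantiated at expressions n with variables as arguments they become symbolic, and
  -- prove ρ e e′ refl checks an identity between two symbolic instances.
  expressions : ℕ → RawRing 0ℓ 0ℓ
  expressions n = record
    { Carrier = Polynomial n ; _≈_ = _≡_
    ; _+_ = _:+_ ; _*_ = _:*_ ; -_ = :-_ ; 0# = con (+ 0) ; 1# = con (+ 1) }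

module _ {c₁ ℓ₁ c₂ ℓ₂} (A : CommutativeRing c₁ ℓ₁) (B : CommutativeRing c₂ ℓ₂) where
  private
    module A = CommutativeRing A
    module B = CommutativeRing B

  mkIsRingHomomorphism : (f : A.Carrier → B.Carrier) →
    (∀ {x y} → x A.≈ y → f x B.≈ f y) →
    (∀ x y → f (x A.+ y) B.≈ f x B.+ f y) →
    (∀ x y → f (x A.* y) B.≈ f x B.* f y) →
    (∀ x → f (A.- x) B.≈ B.- f x) →
    f A.0# B.≈ B.0# →
    f A.1# B.≈ B.1# →
    IsRingHomomorphism A.rawRing B.rawRing f
  mkIsRingHomomorphism f f-cong f-+ f-* f-neg f-0 f-1 = record
    { isSemiringHomomorphism = record
      { isNearSemiringHomomorphism = record
        { +-isMonoidHomomorphism = record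
          { isMagmaHomomorphism = record { isRelHomomorphism = record { cong = f-cong } ; homo = f-+ }
          ; ε-homo = f-0 }
        ; *-homo = f-* }
      ; 1#-homo = f-1 }
    ; -‿homo = f-neg }

module FinSums {c ℓ} (R : CommutativeRing c ℓ) where
  open CommutativeRing R hiding (zero)

  Σᶠ-cong : ∀ {n} {f g : Fin n → Carrier} → (∀ i → f i ≈ g i) → Σᶠ R f ≈ Σᶠ R g
  Σᶠ-cong {zero}  f≈g = refl
  Σᶠ-cong {suc n} f≈g = +-cong (f≈g zero) (Σᶠ-cong (f≈g ∘ suc))

  Πᶠ-cong : ∀ {n} {f g : Fin n → Carrier} → (∀ i → f i ≈ g i) → Πᶠ R f ≈ Πᶠ R g
  Πᶠ-cong {zero}  f≈g = refl
  Πᶠ-cong {suc n} f≈g = *-cong (f≈g zero) (Πᶠ-cong (f≈g ∘ suc))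

  Σᶠ-*ˡ : ∀ {n} k (f : Fin n → Carrier) → Σᶠ R (λ i → k * f i) ≈ k * Σᶠ R f
  Σᶠ-*ˡ {zero}  k f = sym (zeroʳ k)
  Σᶠ-*ˡ {suc n} k f = trans (+-congˡ (Σᶠ-*ˡ k (f ∘ suc))) (sym (distribˡ k _ _))

  Σᶠ-lookup : ∀ {a} {A : Set a} (h : A → Carrier) (L : List A) →
              Σᶠ R (λ j → h (lookup L j)) ≡ sumL R (map h L)
  Σᶠ-lookup h []      = ≡-refl
  Σᶠ-lookup h (p ∷ L) = cong (_+_ (h p)) (Σᶠ-lookup h L)

module _ {c₁ ℓ₁ c₂ ℓ₂} (A : CommutativeRing c₁ ℓ₁) (B : CommutativeRing c₂ ℓ₂)
  {f : CommutativeRing.Carrier A → CommutativeRing.Carrier B}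
  (f-hom : IsRingHomomorphism (CommutativeRing.rawRing A) (CommutativeRing.rawRing B) f) where
  open CommutativeRing B
  open IsRingHomomorphism f-hom

  Σᶠ-homo : ∀ {n} (g : Fin n → CommutativeRing.Carrier A) → f (Σᶠ A g) ≈ Σᶠ B (f ∘ g)
  Σᶠ-homo {zero}  g = 0#-homo
  Σᶠ-homo {suc n} g = trans (+-homo _ _) (+-congˡ (Σᶠ-homo (g ∘ suc)))

-- R[t] / ((t + a)(t + b)(t − u)) in the Newton basis 1, e₁ = t + a, e₂ = (t + a)(t + b): t is the class
-- of the indeterminate, top the coefficient of e₂, and value the evaluation at t = u. The product uses
-- e₁² = e₂ + (a − b)e₁, e₁e₂ = (u + a)e₂ and e₂² = (u + a)(u + b)e₂.
module NewtonArithmetic {c ℓ} (S : RawRing c ℓ) (a b u : RawRing.Carrier S) where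
  open RawRing S

  Triple : Set c
  Triple = Carrier × Carrier × Carrier

  infixl 6 _⊞_
  infixl 7 _⊠_
  infix 8 ⊟_

  _⊞_ _⊠_ : Triple → Triple → Triple
  (p₀ , p₁ , p₂) ⊞ (q₀ , q₁ , q₂) = p₀ + q₀ , p₁ + q₁ , p₂ + q₂
  (p₀ , p₁ , p₂) ⊠ (q₀ , q₁ , q₂) =
      p₀ * q₀
    , p₀ * q₁ + p₁ * q₀ + (a + - b) * (p₁ * q₁)
    , p₀ * q₂ + p₂ * q₀ + p₁ * q₁ + (u + a) * (p₁ * q₂ + p₂ * q₁) + (u + a) * (u + b) * (p₂ * q₂)

  ⊟_ : Triple → Triple
  ⊟ (p₀ , p₁ , p₂) = - p₀ , - p₁ , - p₂

  embed : Carrier → Triple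
  embed k = k , 0# , 0#

  0ᵗ 1ᵗ : Triple
  0ᵗ = embed 0#
  1ᵗ = embed 1#

  t : Triple
  t = - a , 1# , 0#

  top : Triple → Carrier
  top (_ , _ , z₂) = z₂

  value : Triple → Carrier
  value (z₀ , z₁ , z₂) = z₀ + (u + a) * z₁ + (u + a) * (u + b) * z₂

module NewtonQuotient {c ℓ} (R : CommutativeRing c ℓ) (a b u : CommutativeRing.Carrier R) where
  open CommutativeRing R
  open IntegerCoefficients R using (prove; var; con; _:+_; _:*_; :-_; Polynomial; ⟦_⟧; ⟦_⟧↓; expressions)
  open NewtonArithmetic rawRing a b u public
  open import Algebra.Properties.Ring ring using (-0#≈0#)

  private
    G : AbelianGroup c ℓ
    G = DirectProduct.abelianGroup +-abelianGroup (DirectProduct.abelianGroup +-abelianGroup +-abelianGroup)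
    module G = AbelianGroup G

  infix 4 _≈ᵗ_
  _≈ᵗ_ : Triple → Triple → Set ℓ
  _≈ᵗ_ = G._≈_

  private
    module S = NewtonArithmetic (expressions 12) (var (# 0)) (var (# 1)) (var (# 2))
    p̂ q̂ r̂ : S.Triple
    p̂ = var (# 3) , var (# 4) , var (# 5)
    q̂ = var (# 6) , var (# 7) , var (# 8)
    r̂ = var (# 9) , var (# 10) , var (# 11)

    env : Triple → Triple → Triple → Vec Carrier 12
    env (p₀ , p₁ , p₂) (q₀ , q₁ , q₂) (r₀ , r₁ , r₂) =
      a ∷ b ∷ u ∷ p₀ ∷ p₁ ∷ p₂ ∷ q₀ ∷ q₁ ∷ q₂ ∷ r₀ ∷ r₁ ∷ r₂ ∷ []

    ⟦_⟧³ : S.Triple → Vec Carrier 12 → Triple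
    ⟦ e₀ , e₁ , e₂ ⟧³ ρ = ⟦ e₀ ⟧ ρ , ⟦ e₁ ⟧ ρ , ⟦ e₂ ⟧ ρ

    prove³ : ∀ ρ (E F : S.Triple) →
             ⟦ proj₁ E ⟧↓ ρ ≈ ⟦ proj₁ F ⟧↓ ρ →
             ⟦ proj₁ (proj₂ E) ⟧↓ ρ ≈ ⟦ proj₁ (proj₂ F) ⟧↓ ρ →
             ⟦ proj₂ (proj₂ E) ⟧↓ ρ ≈ ⟦ proj₂ (proj₂ F) ⟧↓ ρ →
             ⟦ E ⟧³ ρ ≈ᵗ ⟦ F ⟧³ ρ
    prove³ ρ (e₀ , e₁ , e₂) (f₀ , f₁ , f₂) h₀ h₁ h₂ =
      prove ρ e₀ f₀ h₀ , prove ρ e₁ f₁ h₁ , prove ρ e₂ f₂ h₂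

  ⊠-cong : ∀ {p p′ q q′} → p ≈ᵗ p′ → q ≈ᵗ q′ → p ⊠ q ≈ᵗ p′ ⊠ q′
  ⊠-cong (p₀ , p₁ , p₂) (q₀ , q₁ , q₂) =
      *-cong p₀ q₀
    , +-cong (+-cong (*-cong p₀ q₁) (*-cong p₁ q₀)) (*-congˡ (*-cong p₁ q₁))
    , +-cong (+-cong (+-cong (+-cong (*-cong p₀ q₂) (*-cong p₂ q₀)) (*-cong p₁ q₁))
                     (*-congˡ (+-cong (*-cong p₁ q₂) (*-cong p₂ q₁))))
             (*-congˡ (*-cong p₂ q₂))

  ⊠-comm : ∀ p q → p ⊠ q ≈ᵗ q ⊠ p
  ⊠-comm p q = prove³ (env p q 0ᵗ) (p̂ S.⊠ q̂) (q̂ S.⊠ p̂) refl refl refl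

  ⊠-assoc : ∀ p q r → (p ⊠ q) ⊠ r ≈ᵗ p ⊠ (q ⊠ r)
  ⊠-assoc p q r = prove³ (env p q r) ((p̂ S.⊠ q̂) S.⊠ r̂) (p̂ S.⊠ (q̂ S.⊠ r̂)) refl refl refl

  ⊠-identityˡ : ∀ p → 1ᵗ ⊠ p ≈ᵗ p
  ⊠-identityˡ p = prove³ (env p 0ᵗ 0ᵗ) (S.1ᵗ S.⊠ p̂) p̂ refl refl refl

  ⊠-distribˡ : ∀ p q r → p ⊠ (q ⊞ r) ≈ᵗ (p ⊠ q) ⊞ (p ⊠ r)
  ⊠-distribˡ p q r = prove³ (env p q r) (p̂ S.⊠ (q̂ S.⊞ r̂)) ((p̂ S.⊠ q̂) S.⊞ (p̂ S.⊠ r̂)) refl refl refl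

  quotient-isCommutativeRing : IsCommutativeRing _≈ᵗ_ _⊞_ _⊠_ ⊟_ 0ᵗ 1ᵗ
  quotient-isCommutativeRing = record
    { isRing = record
      { +-isAbelianGroup = G.isAbelianGroup
      ; *-cong = ⊠-cong
      ; *-assoc = ⊠-assoc
      ; *-identity = ⊠-identityˡ , comm∧idˡ⇒idʳ G.setoid ⊠-comm ⊠-identityˡ
      ; distrib = ⊠-distribˡ , comm∧distrˡ⇒distrʳ G.setoid G.∙-cong ⊠-comm ⊠-distribˡ
      }
    ; *-comm = ⊠-comm
    }

  quotient : CommutativeRing c ℓ
  quotient = record { isCommutativeRing = quotient-isCommutativeRing }

  private
    â b̂ û p̂₀ q̂₀ : Polynomial 12
    â = var (# 0)
    b̂ = var (# 1)
    û = var (# 2)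
    p̂₀ = proj₁ p̂
    q̂₀ = proj₁ q̂

  embed-isRingHomomorphism : IsRingHomomorphism rawRing (CommutativeRing.rawRing quotient) embed
  embed-isRingHomomorphism = mkIsRingHomomorphism R quotient embed
    (λ x≈y → x≈y , refl , refl)
    (λ x y → prove³ (env (embed x) (embed y) 0ᵗ)
                    (S.embed (p̂₀ :+ q̂₀)) (S.embed p̂₀ S.⊞ S.embed q̂₀) refl refl refl)
    (λ x y → prove³ (env (embed x) (embed y) 0ᵗ)
                    (S.embed (p̂₀ :* q̂₀)) (S.embed p̂₀ S.⊠ S.embed q̂₀) refl refl refl)
    (λ x → refl , sym -0#≈0# , sym -0#≈0#)
    (refl , refl , refl)
    (refl , refl , refl)

  value-isRingHomomorphism : IsRingHomomorphism (CommutativeRing.rawRing quotient) rawRing value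
  value-isRingHomomorphism = mkIsRingHomomorphism quotient R value
    (λ (e₀ , e₁ , e₂) → +-cong (+-cong e₀ (*-congˡ e₁)) (*-congˡ e₂))
    (λ p q → prove (env p q 0ᵗ) (S.value (p̂ S.⊞ q̂)) (S.value p̂ :+ S.value q̂) refl)
    (λ p q → prove (env p q 0ᵗ) (S.value (p̂ S.⊠ q̂)) (S.value p̂ :* S.value q̂) refl)
    (λ p → prove (env p 0ᵗ 0ᵗ) (S.value (S.⊟ p̂)) (:- S.value p̂) refl)
    (prove (env 0ᵗ 0ᵗ 0ᵗ) (S.value S.0ᵗ) (con (+ 0)) refl)
    (prove (env 0ᵗ 0ᵗ 0ᵗ) (S.value S.1ᵗ) (con (+ 1)) refl)

  value-t : value t ≈ u
  value-t = prove (env 0ᵗ 0ᵗ 0ᵗ) (S.value S.t) û refl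

  value-embed : ∀ k → value (embed k) ≈ k
  value-embed k = prove (env (embed k) 0ᵗ 0ᵗ) (S.value (S.embed p̂₀)) p̂₀ refl

  top-cong : ∀ {p q} → p ≈ᵗ q → top p ≈ top q
  top-cong (_ , _ , e₂) = e₂

  top-newton : ∀ r r′ z → top ((t ⊞ embed a) ⊠ ((t ⊞ embed b) ⊠ z ⊞ embed r′) ⊞ embed r) ≈ value z
  top-newton r r′ z = prove (env (embed r) (embed r′) z)
    (S.top ((S.t S.⊞ S.embed â) S.⊠ ((S.t S.⊞ S.embed b̂) S.⊠ r̂ S.⊞ S.embed q̂₀) S.⊞ S.embed p̂₀))
    (S.value r̂) refl

  top-multiple : ∀ z → top (z ⊠ ((t ⊞ embed a) ⊠ (t ⊞ embed b))) ≈ value z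
  top-multiple z = prove (env z 0ᵗ 0ᵗ)
    (S.top (p̂ S.⊠ ((S.t S.⊞ S.embed â) S.⊠ (S.t S.⊞ S.embed b̂)))) (S.value p̂) refl

module Horner {c₁ ℓ₁ c₂ ℓ₂} (R : CommutativeRing c₁ ℓ₁) (S : CommutativeRing c₂ ℓ₂)
  (ι : CommutativeRing.Carrier R → CommutativeRing.Carrier S)
  (ι-hom : IsRingHomomorphism (CommutativeRing.rawRing R) (CommutativeRing.rawRing S) ι) where
  private module R = CommutativeRing R
  open CommutativeRing S hiding (zero)
  open IsRingHomomorphism ι-hom
  open IntegerCoefficients S using (solve; _:=_; _:+_; _:*_; _:-_; :-_; con)
  open import Algebra.Properties.Ring ring using (-0#≈0#)
  open import Relation.Binary.Reasoning.Setoid setoid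

  horner : Poly R → Carrier → Carrier
  horner p s = foldr (λ k h → ι k + s * h) 0# p

  horner-⊕ : ∀ p q s → horner (_⊕_ R p q) s ≈ horner p s + horner q s
  horner-⊕ []      q       s = sym (+-identityˡ _)
  horner-⊕ (x ∷ p) []      s = sym (+-identityʳ _)
  horner-⊕ (x ∷ p) (y ∷ q) s = begin
    ι (x R.+ y) + s * horner (_⊕_ R p q) s
      ≈⟨ +-cong (+-homo x y) (*-congˡ (horner-⊕ p q s)) ⟩
    (ι x + ι y) + s * (horner p s + horner q s)
      ≈⟨ solve 5 (λ x y s h k → (x :+ y) :+ s :* (h :+ k) := (x :+ s :* h) :+ (y :+ s :* k)) refl (ι x) (ι y) s _ _ ⟩
    (ι x + s * horner p s) + (ι y + s * horner q s)
      ∎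

  horner-scale : ∀ k p s → horner (scale R k p) s ≈ ι k * horner p s
  horner-scale k []      s = sym (zeroʳ _)
  horner-scale k (x ∷ p) s = begin
    ι (k R.* x) + s * horner (scale R k p) s
      ≈⟨ +-cong (*-homo k x) (*-congˡ (horner-scale k p s)) ⟩
    ι k * ι x + s * (ι k * horner p s)
      ≈⟨ solve 4 (λ k x s h → k :* x :+ s :* (k :* h) := k :* (x :+ s :* h)) refl (ι k) (ι x) s _ ⟩
    ι k * (ι x + s * horner p s)
      ∎

  horner-⊗ : ∀ p q s → horner (_⊗_ R p q) s ≈ horner p s * horner q s
  horner-⊗ []      q s = sym (zeroˡ _)
  horner-⊗ (x ∷ p) q s = begin
    horner (_⊕_ R (scale R x q) (R.0# ∷ _⊗_ R p q)) s
      ≈⟨ horner-⊕ (scale R x q) _ s ⟩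
    horner (scale R x q) s + (ι R.0# + s * horner (_⊗_ R p q) s)
      ≈⟨ +-cong (horner-scale x q s) (+-cong 0#-homo (*-congˡ (horner-⊗ p q s))) ⟩
    ι x * horner q s + (0# + s * (horner p s * horner q s))
      ≈⟨ solve 4 (λ x s h k → x :* k :+ (con (+ 0) :+ s :* (h :* k)) := (x :+ s :* h) :* k) refl (ι x) s _ _ ⟩
    (ι x + s * horner p s) * horner q s
      ∎

  horner-⊖ : ∀ p s → horner (⊖_ R p) s ≈ - horner p s
  horner-⊖ []      s = sym -0#≈0#
  horner-⊖ (x ∷ p) s = begin
    ι (R.- x) + s * horner (⊖_ R p) s
      ≈⟨ +-cong (-‿homo x) (*-congˡ (horner-⊖ p s)) ⟩
    - ι x + s * - horner p s
      ≈⟨ solve 3 (λ x s h → :- x :+ s :* :- h := :- (x :+ s :* h)) refl (ι x) s _ ⟩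
    - (ι x + s * horner p s)
      ∎

  horner-const : ∀ k s → horner (const R k) s ≈ ι k
  horner-const k s = trans (+-congˡ (zeroʳ s)) (+-identityʳ _)

  horner-tvar : ∀ s → horner (tvar R) s ≈ s
  horner-tvar s = begin
    ι R.0# + s * (ι R.1# + s * 0#)   ≈⟨ +-cong 0#-homo (*-congˡ (+-cong 1#-homo (zeroʳ s))) ⟩
    0# + s * (1# + 0#)               ≈⟨ solve 1 (λ s → con (+ 0) :+ s :* (con (+ 1) :+ con (+ 0)) := s) refl s ⟩
    s                                ∎

  horner-ΣP : ∀ {n} (f : Fin n → Poly R) s → horner (ΣP R f) s ≈ Σᶠ S (λ i → horner (f i) s)
  horner-ΣP {zero}  f s = refl
  horner-ΣP {suc n} f s = trans (horner-⊕ (f zero) _ s) (+-congˡ (horner-ΣP (f ∘ suc) s))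

  horner-ΠP : ∀ {n} (f : Fin n → Poly R) s → horner (ΠP R f) s ≈ Πᶠ S (λ i → horner (f i) s)
  horner-ΠP {zero}  f s = trans (horner-const R.1# s) 1#-homo
  horner-ΠP {suc n} f s = trans (horner-⊗ (f zero) _ s) (*-congˡ (horner-ΠP (f ∘ suc) s))

  horner-divLin : ∀ p k s → let (q , r) = divLin R p k in horner p s ≈ (s + ι k) * horner q s + ι r
  horner-divLin []       k s = sym (trans (+-cong (zeroʳ _) 0#-homo) (+-identityʳ 0#))
  horner-divLin (a₀ ∷ p) k s with divLin R p k | horner-divLin p k s
  ... | q , r | ih = begin
    ι a₀ + s * horner p s
      ≈⟨ +-congˡ (*-congˡ ih) ⟩
    ι a₀ + s * ((s + ι k) * horner q s + ι r)
      ≈⟨ solve 5 (λ a₀ s k h r → a₀ :+ s :* ((s :+ k) :* h :+ r) := (s :+ k) :* (r :+ s :* h) :+ (a₀ :- k :* r))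
                 refl (ι a₀) s (ι k) (horner q s) (ι r) ⟩
    (s + ι k) * (ι r + s * horner q s) + (ι a₀ - ι k * ι r)
      ≈⟨ +-congˡ (trans (+-homo a₀ _) (+-congˡ (trans (-‿homo _) (-‿cong (*-homo k r))))) ⟨
    (s + ι k) * (ι r + s * horner q s) + ι (a₀ R.- k R.* r)
      ∎

-- For the weights wᵢ = xᵢQ + yᵢP of the pairs (xᵢ, yᵢ) of L, moments P Q L collects
--   π = ∏ᵢ wᵢ,  σ = Σᵢ xᵢyᵢ ∏_{j≠i} wⱼ,  τ = Σ_{i<j} (xᵢyⱼ − xⱼyᵢ)² ∏_{k≠i,j} wₖ,
--   α = Σᵢ xᵢ² ∏_{j≠i} wⱼ,  β = Σᵢ yᵢ² ∏_{j≠i} wⱼ.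
module MomentArithmetic {c ℓ} (S : RawRing c ℓ) where
  open RawRing S

  Moments : Set c
  Moments = Carrier × Carrier × Carrier × Carrier × Carrier

  π σ τ α β : Moments → Carrier
  π (p , _)             = p
  σ (_ , s , _)         = s
  τ (_ , _ , t , _)     = t
  α (_ , _ , _ , a , _) = a
  β (_ , _ , _ , _ , b) = b

  infixl 6 _⊞_
  infixr 7 _⊡_

  _⊞_ : Moments → Moments → Moments
  (p , s , t , a , b) ⊞ (p′ , s′ , t′ , a′ , b′) = p + p′ , s + s′ , t + t′ , a + a′ , b + b′

  _⊡_ : Carrier → Moments → Moments
  k ⊡ (p , s , t , a , b) = k * p , k * s , k * t , k * a , k * b

  step : (P Q x y : Carrier) → Moments → Moments
  step P Q x y (π , σ , τ , α , β) =
      w * π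
    , w * σ + x * y * π
    , w * τ + (y * y * α + x * x * β + - (x * y * σ + x * y * σ))
    , w * α + x * x * π
    , w * β + y * y * π
    where w = x * Q + y * P

  moments : (P Q : Carrier) → List (Carrier × Carrier) → Moments
  moments P Q []             = 1# , 0# , 0# , 0# , 0#
  moments P Q ((x , y) ∷ L) = step P Q x y (moments P Q L)

  Φᴹ : Moments → Carrier
  Φᴹ M = π M + - (σ M + σ M) + - τ M

  Φ : (P Q : Carrier) → List (Carrier × Carrier) → Carrier
  Φ P Q L = Φᴹ (moments P Q L)

module Moments {c ℓ} (A : CommutativeRing c ℓ) where
  open CommutativeRing A hiding (zero)
  open IntegerCoefficients A using (prove; var; con; _:+_; _:*_; _:-_; :-_; Polynomial; ⟦_⟧; ⟦_⟧↓; expressions)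
  open MomentArithmetic rawRing public
  open FinSums A using (Σᶠ-cong; Σᶠ-*ˡ)
  open import Algebra.Properties.CommutativeSemigroup *-commutativeSemigroup using (x∙yz≈y∙xz)
  open import Relation.Binary.Reasoning.Setoid setoid

  private
    Mod : LeftSemimodule semiring c ℓ
    Mod = leftSemimodule U (leftSemimodule U (leftSemimodule U (leftSemimodule U U)))
      where U = TensorUnit.leftSemimodule
    module Mod = LeftSemimodule Mod

  infix 4 _≈ᴹ_
  _≈ᴹ_ : Moments → Moments → Set ℓ
  _≈ᴹ_ = Mod._≈ᴹ_

  open Mod public using (≈ᴹ-setoid; ≈ᴹ-refl; ≈ᴹ-sym; ≈ᴹ-trans) renaming
    ( +ᴹ-magma to ⊞-magma; +ᴹ-cong to ⊞-cong
    ; *ₗ-cong to ⊡-cong; *ₗ-assoc to ⊡-assoc; *ₗ-distribˡ to ⊡-distribˡ; *ₗ-identityˡ to ⊡-identityˡ)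

  Σ₁ Σ₂ : List (Carrier × Carrier) → Carrier
  Σ₁ L = sumL A (map proj₁ L)
  Σ₂ L = sumL A (map proj₂ L)

  private
    module S = MomentArithmetic (expressions 16)
    P̂ Q̂ x̂ ŷ k̂ l̂ : Polynomial 16
    P̂ = var (# 0)
    Q̂ = var (# 1)
    x̂ = var (# 2)
    ŷ = var (# 3)
    k̂ = var (# 4)
    l̂ = var (# 5)
    ŝ t̂ : S.Moments
    ŝ = var (# 6) , var (# 7) , var (# 8) , var (# 9) , var (# 10)
    t̂ = var (# 11) , var (# 12) , var (# 13) , var (# 14) , var (# 15)

    env : (P Q x y k l : Carrier) → Moments → Moments → Vec Carrier 16
    env P Q x y k l (s₁ , s₂ , s₃ , s₄ , s₅) (t₁ , t₂ , t₃ , t₄ , t₅) =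
      P ∷ Q ∷ x ∷ y ∷ k ∷ l ∷ s₁ ∷ s₂ ∷ s₃ ∷ s₄ ∷ s₅ ∷ t₁ ∷ t₂ ∷ t₃ ∷ t₄ ∷ t₅ ∷ []

    M̂₀ : S.Moments
    M̂₀ = S.moments P̂ Q̂ []

    ρ₀ : (P Q : Carrier) → Vec Carrier 16
    ρ₀ P Q = env P Q 0# 0# 0# 0# (moments P Q []) (moments P Q [])

    ⟦_⟧⁵ : S.Moments → Vec Carrier 16 → Moments
    ⟦ e₁ , e₂ , e₃ , e₄ , e₅ ⟧⁵ ρ = ⟦ e₁ ⟧ ρ , ⟦ e₂ ⟧ ρ , ⟦ e₃ ⟧ ρ , ⟦ e₄ ⟧ ρ , ⟦ e₅ ⟧ ρ

    prove⁵ : ∀ ρ (E F : S.Moments) →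
             ⟦ S.π E ⟧↓ ρ ≈ ⟦ S.π F ⟧↓ ρ → ⟦ S.σ E ⟧↓ ρ ≈ ⟦ S.σ F ⟧↓ ρ →
             ⟦ S.τ E ⟧↓ ρ ≈ ⟦ S.τ F ⟧↓ ρ → ⟦ S.α E ⟧↓ ρ ≈ ⟦ S.α F ⟧↓ ρ →
             ⟦ S.β E ⟧↓ ρ ≈ ⟦ S.β F ⟧↓ ρ →
             ⟦ E ⟧⁵ ρ ≈ᴹ ⟦ F ⟧⁵ ρ
    prove⁵ ρ (e₁ , e₂ , e₃ , e₄ , e₅) (f₁ , f₂ , f₃ , f₄ , f₅) h₁ h₂ h₃ h₄ h₅ =
      prove ρ e₁ f₁ h₁ , prove ρ e₂ f₂ h₂ , prove ρ e₃ f₃ h₃ , prove ρ e₄ f₄ h₄ , prove ρ e₅ f₅ h₅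

  step-⊞ : ∀ P Q x y s t → step P Q x y (s ⊞ t) ≈ᴹ step P Q x y s ⊞ step P Q x y t
  step-⊞ P Q x y s t = prove⁵ (env P Q x y 0# 0# s t)
    (S.step P̂ Q̂ x̂ ŷ (ŝ S.⊞ t̂)) (S.step P̂ Q̂ x̂ ŷ ŝ S.⊞ S.step P̂ Q̂ x̂ ŷ t̂) refl refl refl refl refl

  step-⊡ : ∀ P Q x y k t → step P Q x y (k ⊡ t) ≈ᴹ k ⊡ step P Q x y t
  step-⊡ P Q x y k t = prove⁵ (env P Q x y k 0# t t)
    (S.step P̂ Q̂ x̂ ŷ (k̂ S.⊡ ŝ)) (k̂ S.⊡ S.step P̂ Q̂ x̂ ŷ ŝ) refl refl refl refl refl

  step-cong : ∀ P Q x y {s t} → s ≈ᴹ t → step P Q x y s ≈ᴹ step P Q x y t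
  step-cong P Q x y (e₁ , e₂ , e₃ , e₄ , e₅) =
      *-congˡ e₁
    , +-cong (*-congˡ e₂) (*-congˡ e₁)
    , +-cong (*-congˡ e₃)
             (+-cong (+-cong (*-congˡ e₄) (*-congˡ e₅)) (-‿cong (+-cong (*-congˡ e₂) (*-congˡ e₂))))
    , +-cong (*-congˡ e₄) (*-congˡ e₁)
    , +-cong (*-congˡ e₅) (*-congˡ e₁)

  step-shift : ∀ P Q dx dy x y t →
    step (P - dx) (Q - dy) x y t ≈ᴹ (- (dx * y + x * dy)) ⊡ t ⊞ step P Q x y t
  step-shift P Q dx dy x y t = prove⁵ (env P Q x y dx dy t t)
    (S.step (P̂ :- k̂) (Q̂ :- l̂) x̂ ŷ ŝ) ((:- (k̂ :* ŷ :+ x̂ :* l̂)) S.⊡ ŝ S.⊞ S.step P̂ Q̂ x̂ ŷ ŝ)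
    refl refl refl refl refl

  Φᴹ-cong : ∀ {s t} → s ≈ᴹ t → Φᴹ s ≈ Φᴹ t
  Φᴹ-cong (e₁ , e₂ , e₃ , _) = +-cong (+-cong e₁ (-‿cong (+-cong e₂ e₂))) (-‿cong e₃)

  Φᴹ-⊞ : ∀ s t → Φᴹ (s ⊞ t) ≈ Φᴹ s + Φᴹ t
  Φᴹ-⊞ s t = prove (env 0# 0# 0# 0# 0# 0# s t) (S.Φᴹ (ŝ S.⊞ t̂)) (S.Φᴹ ŝ :+ S.Φᴹ t̂) refl

  Φᴹ-⊡ : ∀ k t → Φᴹ (k ⊡ t) ≈ k * Φᴹ t
  Φᴹ-⊡ k t = prove (env 0# 0# 0# 0# k 0# t t) (S.Φᴹ (k̂ S.⊡ ŝ)) (k̂ :* S.Φᴹ ŝ) refl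

  α-relation : ∀ P Q L → let M = moments P Q L in Q * α M + P * σ M ≈ Σ₁ L * π M
  α-relation P Q [] = prove (ρ₀ P Q) (Q̂ :* S.α M̂₀ :+ P̂ :* S.σ M̂₀) (con (+ 0) :* S.π M̂₀) refl
  α-relation P Q ((x , y) ∷ L) = begin
    Q * α (step P Q x y M) + P * σ (step P Q x y M)
      ≈⟨ prove ρ (Q̂ :* S.α (S.step P̂ Q̂ x̂ ŷ ŝ) :+ P̂ :* S.σ (S.step P̂ Q̂ x̂ ŷ ŝ))
                 (ŵ :* (Q̂ :* S.α ŝ :+ P̂ :* S.σ ŝ) :+ x̂ :* ŵ :* S.π ŝ) refl ⟩
    w * (Q * α M + P * σ M) + x * w * π M
      ≈⟨ +-congʳ (*-congˡ (α-relation P Q L)) ⟩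
    w * (Σ₁ L * π M) + x * w * π M
      ≈⟨ prove ρ (ŵ :* (k̂ :* S.π ŝ) :+ x̂ :* ŵ :* S.π ŝ) ((x̂ :+ k̂) :* S.π (S.step P̂ Q̂ x̂ ŷ ŝ)) refl ⟩
    (x + Σ₁ L) * π (step P Q x y M)
      ∎
    where
      M : Moments
      M = moments P Q L
      w : Carrier
      w = x * Q + y * P
      ŵ : Polynomial 16
      ŵ = x̂ :* Q̂ :+ ŷ :* P̂
      ρ : Vec Carrier 16
      ρ = env P Q x y (Σ₁ L) 0# M M

  β-relation : ∀ P Q L → let M = moments P Q L in P * β M + Q * σ M ≈ Σ₂ L * π M
  β-relation P Q [] = prove (ρ₀ P Q) (P̂ :* S.β M̂₀ :+ Q̂ :* S.σ M̂₀) (con (+ 0) :* S.π M̂₀) refl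
  β-relation P Q ((x , y) ∷ L) = begin
    P * β (step P Q x y M) + Q * σ (step P Q x y M)
      ≈⟨ prove ρ (P̂ :* S.β (S.step P̂ Q̂ x̂ ŷ ŝ) :+ Q̂ :* S.σ (S.step P̂ Q̂ x̂ ŷ ŝ))
                 (ŵ :* (P̂ :* S.β ŝ :+ Q̂ :* S.σ ŝ) :+ ŷ :* ŵ :* S.π ŝ) refl ⟩
    w * (P * β M + Q * σ M) + y * w * π M
      ≈⟨ +-congʳ (*-congˡ (β-relation P Q L)) ⟩
    w * (Σ₂ L * π M) + y * w * π M
      ≈⟨ prove ρ (ŵ :* (l̂ :* S.π ŝ) :+ ŷ :* ŵ :* S.π ŝ) ((ŷ :+ l̂) :* S.π (S.step P̂ Q̂ x̂ ŷ ŝ)) refl ⟩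
    (y + Σ₂ L) * π (step P Q x y M)
      ∎
    where
      M : Moments
      M = moments P Q L
      w : Carrier
      w = x * Q + y * P
      ŵ : Polynomial 16
      ŵ = x̂ :* Q̂ :+ ŷ :* P̂
      ρ : Vec Carrier 16
      ρ = env P Q x y 0# (Σ₂ L) M M

  τ-relation : ∀ P Q L → let M = moments P Q L in
    P * Q * τ M ≈ Σ₁ L * Σ₂ L * π M - (Q * Σ₁ L + P * Σ₂ L) * σ M
  τ-relation P Q [] = prove (ρ₀ P Q)
    (P̂ :* Q̂ :* S.τ M̂₀) (con (+ 0) :* con (+ 0) :* S.π M̂₀ :- (Q̂ :* con (+ 0) :+ P̂ :* con (+ 0)) :* S.σ M̂₀) refl
  τ-relation P Q ((x , y) ∷ L) = begin
    P * Q * τ (step P Q x y M)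
      ≈⟨ prove ρ (P̂ :* Q̂ :* S.τ (S.step P̂ Q̂ x̂ ŷ ŝ))
                 (ŵ :* (P̂ :* Q̂ :* S.τ ŝ) :+ P̂ :* ŷ :* ŷ :* (Q̂ :* S.α ŝ :+ P̂ :* S.σ ŝ)
                    :+ Q̂ :* x̂ :* x̂ :* (P̂ :* S.β ŝ :+ Q̂ :* S.σ ŝ) :- d̂ :* S.σ ŝ) refl ⟩
    w * (P * Q * τ M) + P * y * y * (Q * α M + P * σ M) + Q * x * x * (P * β M + Q * σ M) - d * σ M
      ≈⟨ +-congʳ (+-cong (+-cong (*-congˡ (τ-relation P Q L)) (*-congˡ (α-relation P Q L)))
                         (*-congˡ (β-relation P Q L))) ⟩
    w * (X * Y * π M - (Q * X + P * Y) * σ M) + P * y * y * (X * π M) + Q * x * x * (Y * π M) - d * σ M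
      ≈⟨ prove ρ (ŵ :* (k̂ :* l̂ :* S.π ŝ :- (Q̂ :* k̂ :+ P̂ :* l̂) :* S.σ ŝ) :+ P̂ :* ŷ :* ŷ :* (k̂ :* S.π ŝ)
                    :+ Q̂ :* x̂ :* x̂ :* (l̂ :* S.π ŝ) :- d̂ :* S.σ ŝ)
                 ((x̂ :+ k̂) :* (ŷ :+ l̂) :* S.π (S.step P̂ Q̂ x̂ ŷ ŝ)
                    :- (Q̂ :* (x̂ :+ k̂) :+ P̂ :* (ŷ :+ l̂)) :* S.σ (S.step P̂ Q̂ x̂ ŷ ŝ)) refl ⟩
    (x + X) * (y + Y) * π (step P Q x y M) - (Q * (x + X) + P * (y + Y)) * σ (step P Q x y M)
      ∎
    where
      M : Moments
      M = moments P Q L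
      X Y w d : Carrier
      X = Σ₁ L
      Y = Σ₂ L
      w = x * Q + y * P
      d = P * P * y * y + Q * Q * x * x + P * Q * x * y + P * Q * x * y
      ŵ d̂ : Polynomial 16
      ŵ = x̂ :* Q̂ :+ ŷ :* P̂
      d̂ = P̂ :* P̂ :* ŷ :* ŷ :+ Q̂ :* Q̂ :* x̂ :* x̂ :+ P̂ :* Q̂ :* x̂ :* ŷ :+ P̂ :* Q̂ :* x̂ :* ŷ
      ρ : Vec Carrier 16
      ρ = env P Q x y X Y M M

  Φ*PQ : ∀ P Q L → let M = moments P Q L in
    Φ P Q L * (P * Q) ≈ (P * Q - Σ₁ L * Σ₂ L) * π M - (Q * (P - Σ₁ L) + P * (Q - Σ₂ L)) * σ M
  Φ*PQ P Q L = begin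
    Φᴹ M * (P * Q)
      ≈⟨ prove ρ (S.Φᴹ ŝ :* (P̂ :* Q̂)) ((S.π ŝ :- (S.σ ŝ :+ S.σ ŝ)) :* (P̂ :* Q̂) :- P̂ :* Q̂ :* S.τ ŝ) refl ⟩
    (π M - (σ M + σ M)) * (P * Q) - P * Q * τ M
      ≈⟨ +-congˡ (-‿cong (τ-relation P Q L)) ⟩
    (π M - (σ M + σ M)) * (P * Q) - (Σ₁ L * Σ₂ L * π M - (Q * Σ₁ L + P * Σ₂ L) * σ M)
      ≈⟨ prove ρ ((S.π ŝ :- (S.σ ŝ :+ S.σ ŝ)) :* (P̂ :* Q̂) :- (k̂ :* l̂ :* S.π ŝ :- (Q̂ :* k̂ :+ P̂ :* l̂) :* S.σ ŝ))
                 ((P̂ :* Q̂ :- k̂ :* l̂) :* S.π ŝ :- (Q̂ :* (P̂ :- k̂) :+ P̂ :* (Q̂ :- l̂)) :* S.σ ŝ) refl ⟩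
    (P * Q - Σ₁ L * Σ₂ L) * π M - (Q * (P - Σ₁ L) + P * (Q - Σ₂ L)) * σ M
      ∎
    where
      M : Moments
      M = moments P Q L
      ρ : Vec Carrier 16
      ρ = env P Q 0# 0# (Σ₁ L) (Σ₂ L) M M

  Φ*PQ≈0 : ∀ L {P Q} → Σ₁ L ≡ P → Σ₂ L ≡ Q → Φ P Q L * (P * Q) ≈ 0#
  Φ*PQ≈0 L ≡-refl ≡-refl = trans (Φ*PQ X Y L)
    (prove (env X Y 0# 0# 0# 0# M M)
      ((P̂ :* Q̂ :- P̂ :* Q̂) :* S.π ŝ :- (Q̂ :* (P̂ :- P̂) :+ P̂ :* (Q̂ :- Q̂)) :* S.σ ŝ) (con (+ 0)) refl)
    where
      X Y : Carrier
      X = Σ₁ L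
      Y = Σ₂ L
      M : Moments
      M = moments X Y L

  numerator-cons : ∀ x y L {P Q} → x + Σ₁ L ≡ P → y + Σ₂ L ≡ Q →
    let M = moments P Q ((x , y) ∷ L) in π M - σ M ≈ Φ P Q L * (P * Q)
  numerator-cons x y L ≡-refl ≡-refl = sym (trans (Φ*PQ P Q L)
    (prove (env 0# 0# x y (Σ₁ L) (Σ₂ L) M M)
      ((P̂′ :* Q̂′ :- k̂ :* l̂) :* S.π ŝ :- (Q̂′ :* (P̂′ :- k̂) :+ P̂′ :* (Q̂′ :- l̂)) :* S.σ ŝ)
      (S.π (S.step P̂′ Q̂′ x̂ ŷ ŝ) :- S.σ (S.step P̂′ Q̂′ x̂ ŷ ŝ)) refl))
    where
      P Q : Carrier
      P = x + Σ₁ L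
      Q = y + Σ₂ L
      M : Moments
      M = moments P Q L
      P̂′ Q̂′ : Polynomial 16
      P̂′ = x̂ :+ k̂
      Q̂′ = ŷ :+ l̂

  Σ₁-tabulate : ∀ {k} (xs ys : Fin k → Carrier) → Σ₁ (tabulate (λ i → xs i , ys i)) ≡ Σᶠ A xs
  Σ₁-tabulate {zero}  xs ys = ≡-refl
  Σ₁-tabulate {suc k} xs ys = cong (_+_ (xs zero)) (Σ₁-tabulate (xs ∘ suc) (ys ∘ suc))

  Σ₂-tabulate : ∀ {k} (xs ys : Fin k → Carrier) → Σ₂ (tabulate (λ i → xs i , ys i)) ≡ Σᶠ A ys
  Σ₂-tabulate {zero}  xs ys = ≡-refl
  Σ₂-tabulate {suc k} xs ys = cong (_+_ (ys zero)) (Σ₂-tabulate (xs ∘ suc) (ys ∘ suc))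

  Πᶠ-weights : ∀ {k} P Q (xs ys : Fin k → Carrier) →
    Πᶠ A (λ i → xs i * Q + ys i * P) ≈ π (moments P Q (tabulate (λ i → xs i , ys i)))
  Πᶠ-weights {zero}  P Q xs ys = refl
  Πᶠ-weights {suc k} P Q xs ys = *-congˡ (Πᶠ-weights P Q (xs ∘ suc) (ys ∘ suc))

  Σᶠ-weights : ∀ {k} P Q (xs ys : Fin k → Carrier) →
    Σᶠ A (λ i → xs i * ys i * Πᶠ A (λ j → if does (i ≟ j) then 1# else xs j * Q + ys j * P))
      ≈ σ (moments P Q (tabulate (λ i → xs i , ys i)))
  Σᶠ-weights {zero}  P Q xs ys = refl
  Σᶠ-weights {suc k} P Q xs ys = begin
    xs zero * ys zero * (1# * Πᶠ A (w ∘ suc)) + Σᶠ A (λ i → xs (suc i) * ys (suc i) * (w zero * Π′ i))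
      ≈⟨ +-cong (*-congˡ (*-identityˡ _))
                (trans (Σᶠ-cong (λ i → x∙yz≈y∙xz (xs (suc i) * ys (suc i)) (w zero) (Π′ i)))
                       (Σᶠ-*ˡ (w zero) (λ i → xs (suc i) * ys (suc i) * Π′ i))) ⟩
    xs zero * ys zero * Πᶠ A (w ∘ suc) + w zero * Σᶠ A (λ i → xs (suc i) * ys (suc i) * Π′ i)
      ≈⟨ +-cong (*-congˡ (Πᶠ-weights P Q (xs ∘ suc) (ys ∘ suc))) (*-congˡ (Σᶠ-weights P Q (xs ∘ suc) (ys ∘ suc))) ⟩
    xs zero * ys zero * π M + w zero * σ M
      ≈⟨ +-comm _ _ ⟩
    w zero * σ M + xs zero * ys zero * π M
      ∎
    where
      w : Fin (suc k) → Carrier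
      w j = xs j * Q + ys j * P
      Π′ : Fin k → Carrier
      Π′ i = Πᶠ A (λ j → if does (i ≟ j) then 1# else w (suc j))
      M : Moments
      M = moments P Q (tabulate (λ i → xs (suc i) , ys (suc i)))

  numerator : ∀ {m} (xs ys : Fin (suc m) → Carrier) → Carrier
  numerator xs ys = Πᶠ A w + - Σᶠ A (λ i → xs i * ys i * Πᶠ A (λ j → if does (i ≟ j) then 1# else w j))
    where
      w : Fin _ → Carrier
      w i = xs i * Σᶠ A ys + ys i * Σᶠ A xs

  numerator-Φ : ∀ {m} (xs ys : Fin (suc m) → Carrier) →
    numerator xs ys ≈ Φ (Σᶠ A xs) (Σᶠ A ys) (tabulate (λ i → xs (suc i) , ys (suc i))) * (Σᶠ A xs * Σᶠ A ys)
  numerator-Φ xs ys = trans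
    (+-cong (Πᶠ-weights (Σᶠ A xs) (Σᶠ A ys) xs ys) (-‿cong (Σᶠ-weights (Σᶠ A xs) (Σᶠ A ys) xs ys)))
    (numerator-cons (xs zero) (ys zero) (tabulate (λ i → xs (suc i) , ys (suc i)))
                    (cong (_+_ (xs zero)) (Σ₁-tabulate (xs ∘ suc) (ys ∘ suc)))
                    (cong (_+_ (ys zero)) (Σ₂-tabulate (xs ∘ suc) (ys ∘ suc))))

module _ {c₁ ℓ₁ c₂ ℓ₂} (A : CommutativeRing c₁ ℓ₁) (B : CommutativeRing c₂ ℓ₂)
  {f : CommutativeRing.Carrier A → CommutativeRing.Carrier B}
  (f-hom : IsRingHomomorphism (CommutativeRing.rawRing A) (CommutativeRing.rawRing B) f) where
  private
    module A = CommutativeRing A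
    module Aᴹ = Moments A
    module Bᴹ = Moments B
  open CommutativeRing B
  open IsRingHomomorphism f-hom

  private
    _+ʰ_ : ∀ {x y x′ y′} → f x ≈ x′ → f y ≈ y′ → f (x A.+ y) ≈ x′ + y′
    p +ʰ q = trans (+-homo _ _) (+-cong p q)
    _*ʰ_ : ∀ {x y x′ y′} → f x ≈ x′ → f y ≈ y′ → f (x A.* y) ≈ x′ * y′
    p *ʰ q = trans (*-homo _ _) (*-cong p q)
    -ʰ_ : ∀ {x x′} → f x ≈ x′ → f (A.- x) ≈ - x′
    -ʰ p = trans (-‿homo _) (-‿cong p)
    infixl 6 _+ʰ_
    infixl 7 _*ʰ_
    infix 8 -ʰ_

  RelatedPairs : A.Carrier × A.Carrier → Carrier × Carrier → Set ℓ₂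
  RelatedPairs (x , y) (x′ , y′) = f x ≈ x′ × f y ≈ y′

  map-moments : Aᴹ.Moments → Bᴹ.Moments
  map-moments (p , s , t , a , b) = f p , f s , f t , f a , f b

  moments-homo : ∀ {P Q P′ Q′ L L′} → f P ≈ P′ → f Q ≈ Q′ → Pointwise RelatedPairs L L′ →
                 map-moments (Aᴹ.moments P Q L) Bᴹ.≈ᴹ Bᴹ.moments P′ Q′ L′
  moments-homo fP fQ []                = 1#-homo , 0#-homo , 0#-homo , 0#-homo , 0#-homo
  moments-homo fP fQ ((fx , fy) ∷ fL) with moments-homo fP fQ fL
  ... | (p , s , t , a , b) =
      w *ʰ p
    , w *ʰ s +ʰ fx *ʰ fy *ʰ p
    , w *ʰ t +ʰ (fy *ʰ fy *ʰ a +ʰ fx *ʰ fx *ʰ b +ʰ -ʰ (fx *ʰ fy *ʰ s +ʰ fx *ʰ fy *ʰ s))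
    , w *ʰ a +ʰ fx *ʰ fx *ʰ p
    , w *ʰ b +ʰ fy *ʰ fy *ʰ p
    where w = fx *ʰ fQ +ʰ fy *ʰ fP

  Φ-homo : ∀ {P Q P′ Q′ L L′} → f P ≈ P′ → f Q ≈ Q′ → Pointwise RelatedPairs L L′ →
           f (Aᴹ.Φ P Q L) ≈ Bᴹ.Φ P′ Q′ L′
  Φ-homo fP fQ fL with moments-homo fP fQ fL
  ... | (p , s , t , _) = p +ʰ -ʰ (s +ʰ s) +ʰ -ʰ t

module _ {c ℓ} (A : CommutativeRing c ℓ) where
  open CommutativeRing A
  open Moments A using (Φ)

  Φ-cong : ∀ {P Q P′ Q′} L → P ≈ P′ → Q ≈ Q′ → Φ P Q L ≈ Φ P′ Q′ L
  Φ-cong L P≈P′ Q≈Q′ =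
    Φ-homo A A (Identity.isRingHomomorphism rawRing refl) P≈P′ Q≈Q′ (Pointwise-refl (refl , refl) {L})

module GenericPoint {c ℓ} (R : CommutativeRing c ℓ) {m : ℕ} (x y : Fin (suc m) → CommutativeRing.Carrier R) where
  open CommutativeRing R hiding (zero)
  open FinSums R using (Σᶠ-cong)
  open Moments R using (Φ)

  u e a b : Carrier
  u = x zero
  e = y zero - x zero
  a = Σᶠ R (x ∘ suc)
  b = e + Σᶠ R (y ∘ suc)

  -- The where block of φ in Defs, clause for clause, so that φ R x y unfolds to evalP R q₂ u in φ≈Φ.
  xt yt : Fin (suc m) → Poly R
  xt zero    = tvar R
  xt (suc i) = const R (x (suc i))
  yt zero    = _⊕_ R (tvar R) (const R e)
  yt (suc i) = const R (y (suc i))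

  fac : Fin (suc m) → Poly R
  fac i = _⊕_ R (_⊗_ R (xt i) (ΣP R yt)) (_⊗_ R (yt i) (ΣP R xt))

  fac-except : Fin (suc m) → Fin (suc m) → Poly R
  fac-except i j = if does (i ≟ j) then const R 1# else fac j

  summand : Fin (suc m) → Poly R
  summand i = _⊗_ R (_⊗_ R (xt i) (yt i)) (ΠP R (fac-except i))

  N : Poly R
  N = _⊕_ R (ΠP R fac) (⊖_ R (ΣP R summand))

  open NewtonQuotient R a b u
  module J = CommutativeRing quotient
  module Jᴹ = Moments quotient
  open Horner R quotient embed embed-isRingHomomorphism
  open IsRingHomomorphism value-isRingHomomorphism renaming (⟦⟧-cong to value-cong)

  ξ η : Fin (suc m) → Triple
  ξ i = horner (xt i) t
  η i = horner (yt i) t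

  value-horner : ∀ p → value (horner p t) ≈ evalP R p u
  value-horner []      = 0#-homo
  value-horner (k ∷ p) =
    trans (+-homo _ _) (+-cong (value-embed k) (trans (*-homo _ _) (*-cong value-t (value-horner p))))

  value-ξ : ∀ i → value (ξ i) ≈ x i
  value-ξ zero    = trans (value-cong (horner-tvar t)) value-t
  value-ξ (suc i) = trans (value-cong (horner-const _ t)) (value-embed _)

  value-η : ∀ i → value (η i) ≈ y i
  value-η zero    = begin
    value (horner (_⊕_ R (tvar R) (const R e)) t)
      ≈⟨ value-cong (J.trans (horner-⊕ (tvar R) (const R e) t) (J.+-cong (horner-tvar t) (horner-const e t))) ⟩
    value (t ⊞ embed e)
      ≈⟨ trans (+-homo _ _) (+-cong value-t (value-embed e)) ⟩
    x zero + (y zero - x zero)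
      ≈⟨ solve 2 (λ x₀ y₀ → x₀ :+ (y₀ :- x₀) := y₀) refl (x zero) (y zero) ⟩
    y zero
      ∎
    where open import Relation.Binary.Reasoning.Setoid setoid
          open IntegerCoefficients R using (solve; _:=_; _:+_; _:-_)
  value-η (suc i) = trans (value-cong (horner-const _ t)) (value-embed _)

  private
    module JΣ = FinSums quotient

  Σξ : Σᶠ quotient ξ ≈ᵗ t ⊞ embed a
  Σξ = J.+-cong (horner-tvar t)
    (J.trans (JΣ.Σᶠ-cong (λ i → horner-const (x (suc i)) t))
             (J.sym (Σᶠ-homo R quotient embed-isRingHomomorphism (x ∘ suc))))

  Ση : Σᶠ quotient η ≈ᵗ t ⊞ embed b
  Ση = begin
    η zero ⊞ Σᶠ quotient (η ∘ suc)
      ≈⟨ J.+-cong (J.trans (horner-⊕ (tvar R) (const R e) t) (J.+-congʳ (horner-tvar t)))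
                  (JΣ.Σᶠ-cong (λ i → horner-const (y (suc i)) t)) ⟩
    (t ⊞ horner (const R e) t) ⊞ Σᶠ quotient (embed ∘ y ∘ suc)
      ≈⟨ J.+-assoc _ _ _ ⟩
    t ⊞ (horner (const R e) t ⊞ Σᶠ quotient (embed ∘ y ∘ suc))
      ≈⟨ J.+-congˡ (J.+-cong (horner-const e t) (J.sym (Σᶠ-homo R quotient embed-isRingHomomorphism (y ∘ suc)))) ⟩
    t ⊞ (embed e ⊞ embed (Σᶠ R (y ∘ suc)))
      ≈⟨ J.+-congˡ (J.sym (IsRingHomomorphism.+-homo embed-isRingHomomorphism e _)) ⟩
    t ⊞ embed b
      ∎
    where open import Relation.Binary.Reasoning.Setoid J.setoid

  ΣξΣη : Σᶠ quotient ξ ⊠ Σᶠ quotient η ≈ᵗ (t ⊞ embed a) ⊠ (t ⊞ embed b)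
  ΣξΣη = J.*-cong Σξ Ση

  w : Fin (suc m) → Triple
  w i = ξ i ⊠ Σᶠ quotient η ⊞ η i ⊠ Σᶠ quotient ξ

  horner-fac : ∀ i → horner (fac i) t ≈ᵗ w i
  horner-fac i = J.trans (horner-⊕ (_⊗_ R (xt i) (ΣP R yt)) (_⊗_ R (yt i) (ΣP R xt)) t)
    (J.+-cong (J.trans (horner-⊗ (xt i) (ΣP R yt) t) (J.*-congˡ (horner-ΣP yt t)))
              (J.trans (horner-⊗ (yt i) (ΣP R xt) t) (J.*-congˡ (horner-ΣP xt t))))

  horner-summand : ∀ i → horner (summand i) t ≈ᵗ ξ i ⊠ η i ⊠ Πᶠ quotient (λ j → if does (i ≟ j) then J.1# else w j)
  horner-summand i = J.trans (horner-⊗ (_⊗_ R (xt i) (yt i)) (ΠP R (fac-except i)) t)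
    (J.*-cong (horner-⊗ (xt i) (yt i) t)
              (J.trans (horner-ΠP (fac-except i) t) (JΣ.Πᶠ-cong (λ j → horner-if (does (i ≟ j)) j))))
    where
      horner-if : ∀ (β : Bool) j → horner (if β then const R 1# else fac j) t ≈ᵗ (if β then J.1# else w j)
      horner-if true  j = horner-const 1# t
      horner-if false j = horner-fac j

  horner-N : horner N t ≈ᵗ Jᴹ.numerator ξ η
  horner-N = J.trans (horner-⊕ (ΠP R fac) (⊖_ R (ΣP R summand)) t)
    (J.+-cong (J.trans (horner-ΠP fac t) (JΣ.Πᶠ-cong horner-fac))
              (J.trans (horner-⊖ (ΣP R summand) t)
                       (J.-‿cong (J.trans (horner-ΣP summand t) (JΣ.Σᶠ-cong horner-summand)))))

  value-Φ : ∀ {k} (ι : Fin k → Fin (suc m)) →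
    value (Jᴹ.Φ (Σᶠ quotient ξ) (Σᶠ quotient η) (tabulate (λ i → ξ (ι i) , η (ι i))))
      ≈ Φ (Σᶠ R x) (Σᶠ R y) (tabulate (λ i → x (ι i) , y (ι i)))
  value-Φ ι = Φ-homo quotient R value-isRingHomomorphism
    (trans (Σᶠ-homo quotient R value-isRingHomomorphism ξ) (Σᶠ-cong value-ξ))
    (trans (Σᶠ-homo quotient R value-isRingHomomorphism η) (Σᶠ-cong value-η))
    (tabulate⁺ {f = λ i → ξ (ι i) , η (ι i)} {g = λ i → x (ι i) , y (ι i)} (λ i → value-ξ (ι i) , value-η (ι i)))

  φ≈Φ : φ R x y ≈ Φ (Σᶠ R x) (Σᶠ R y) (tabulate (λ i → x (suc i) , y (suc i)))
  φ≈Φ = begin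
    evalP R q₂ u                                     ≈⟨ value-horner q₂ ⟨
    value (horner q₂ t)                              ≈⟨ top-newton r₁ r₂ (horner q₂ t) ⟨
    top ((t ⊞ embed a) ⊠ ((t ⊞ embed b) ⊠ horner q₂ t ⊞ embed r₂) ⊞ embed r₁)
      ≈⟨ top-cong (J.+-cong (J.*-congˡ (horner-divLin q₁ b t)) (J.refl {embed r₁})) ⟨
    top ((t ⊞ embed a) ⊠ horner q₁ t ⊞ embed r₁)     ≈⟨ top-cong (horner-divLin N a t) ⟨
    top (horner N t)                                 ≈⟨ top-cong horner-N ⟩
    top (Jᴹ.numerator ξ η)                           ≈⟨ top-cong (Jᴹ.numerator-Φ ξ η) ⟩
    top (Φᴶ ⊠ (Σᶠ quotient ξ ⊠ Σᶠ quotient η))      ≈⟨ top-cong (J.*-congˡ ΣξΣη) ⟩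
    top (Φᴶ ⊠ ((t ⊞ embed a) ⊠ (t ⊞ embed b)))      ≈⟨ top-multiple Φᴶ ⟩
    value Φᴶ                                         ≈⟨ value-Φ suc ⟩
    Φ (Σᶠ R x) (Σᶠ R y) (tabulate (λ i → x (suc i) , y (suc i)))
      ∎
    where
      open import Relation.Binary.Reasoning.Setoid setoid
      q₁ q₂ : Poly R
      q₁ = proj₁ (divLin R N a)
      q₂ = proj₁ (divLin R q₁ b)
      r₁ r₂ : Carrier
      r₁ = proj₂ (divLin R N a)
      r₂ = proj₂ (divLin R q₁ b)
      Φᴶ : Triple
      Φᴶ = Jᴹ.Φ (Σᶠ quotient ξ) (Σᶠ quotient η) (tabulate (λ i → ξ (suc i) , η (suc i)))

  Φ-self≈0 : Φ (Σᶠ R x) (Σᶠ R y) (tabulate (λ i → x i , y i)) ≈ 0#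
  Φ-self≈0 = begin
    Φ (Σᶠ R x) (Σᶠ R y) (tabulate (λ i → x i , y i))   ≈⟨ value-Φ (λ i → i) ⟨
    value Ψ                                             ≈⟨ top-multiple Ψ ⟨
    top (Ψ ⊠ ((t ⊞ embed a) ⊠ (t ⊞ embed b)))          ≈⟨ top-cong (J.*-congˡ ΣξΣη) ⟨
    top (Ψ ⊠ (Σᶠ quotient ξ ⊠ Σᶠ quotient η))
      ≈⟨ top-cong (Jᴹ.Φ*PQ≈0 (tabulate (λ i → ξ i , η i)) (Jᴹ.Σ₁-tabulate ξ η) (Jᴹ.Σ₂-tabulate ξ η)) ⟩
    0#
      ∎
    where
      open import Relation.Binary.Reasoning.Setoid setoid
      Ψ : Triple
      Ψ = Jᴹ.Φ (Σᶠ quotient ξ) (Σᶠ quotient η) (tabulate (λ i → ξ i , η i))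

module SubsetSum {a ℓ} (M : Magma a ℓ) where
  open Magma M

  Σˢ : ∀ {m} → (Subset m → Carrier) → Carrier
  Σˢ {zero}  F = F []
  Σˢ {suc m} F = Σˢ (F ∘ (inside ∷_)) ∙ Σˢ (F ∘ (outside ∷_))

  Σˢ-cong : ∀ {m} {F G : Subset m → Carrier} → (∀ I → F I ≈ G I) → Σˢ F ≈ Σˢ G
  Σˢ-cong {zero}  F≈G = F≈G []
  Σˢ-cong {suc m} F≈G = ∙-cong (Σˢ-cong (F≈G ∘ (inside ∷_))) (Σˢ-cong (F≈G ∘ (outside ∷_)))

module _ {a₁ ℓ₁ a₂ ℓ₂} (M : Magma a₁ ℓ₁) (N : Magma a₂ ℓ₂) where
  private
    module M = Magma M
    module N = Magma N
  open SubsetSum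

  Σˢ-homo : (f : M.Carrier → N.Carrier) → (∀ x y → f (x M.∙ y) N.≈ f x N.∙ f y) →
            ∀ {m} (F : Subset m → M.Carrier) → f (Σˢ M F) N.≈ Σˢ N (f ∘ F)
  Σˢ-homo f f-∙ {zero}  F = N.refl
  Σˢ-homo f f-∙ {suc m} F =
    N.trans (f-∙ _ _) (N.∙-cong (Σˢ-homo f f-∙ (F ∘ (inside ∷_))) (Σˢ-homo f f-∙ (F ∘ (outside ∷_))))

module RingSubsetSums {c ℓ} (R : CommutativeRing c ℓ) where
  open CommutativeRing R hiding (zero)
  open SubsetSum +-magma
  open import Algebra.Properties.AbelianGroup +-abelianGroup using (⁻¹-∙-comm)
  open import Algebra.Properties.Ring ring using (-‿distribˡ-*)
  open IntegerCoefficients R using (solve; _:=_; _:+_; _:*_; _:-_; :-_; con)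
  open import Relation.Binary.Reasoning.Setoid setoid

  sumL-++ : ∀ xs ys → sumL R (xs ++ ys) ≈ sumL R xs + sumL R ys
  sumL-++ []       ys = sym (+-identityˡ _)
  sumL-++ (x ∷ xs) ys = trans (+-congˡ (sumL-++ xs ys)) (sym (+-assoc _ _ _))

  sumL-filter : ∀ {a p} {A : Set a} {P : A → Set p} (P? : ∀ x → Dec (P x)) (F : A → Carrier) L →
    sumL R (map F (filter P? L)) ≈ sumL R (map (λ I → if does (P? I) then F I else 0#) L)
  sumL-filter P? F []      = refl
  sumL-filter P? F (I ∷ L) with does (P? I)
  ... | true  = +-congˡ (sumL-filter P? F L)
  ... | false = trans (sumL-filter P? F L) (sym (+-identityˡ _))

  sumL-allSubsets : ∀ {m} (F : Subset m → Carrier) → sumL R (map F (allSubsets m)) ≈ Σˢ F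
  sumL-allSubsets {zero}  F = +-identityʳ _
  sumL-allSubsets {suc m} F = begin
    sumL R (map F (map (inside ∷_) S ++ map (outside ∷_) S))
      ≡⟨ cong (sumL R) (map-++ F (map (inside ∷_) S) (map (outside ∷_) S)) ⟩
    sumL R (map F (map (inside ∷_) S) ++ map F (map (outside ∷_) S))
      ≈⟨ sumL-++ (map F (map (inside ∷_) S)) _ ⟩
    sumL R (map F (map (inside ∷_) S)) + sumL R (map F (map (outside ∷_) S))
      ≡⟨ cong₂ (λ l l′ → sumL R l + sumL R l′) (map-∘ S) (map-∘ S) ⟨
    sumL R (map (F ∘ (inside ∷_)) S) + sumL R (map (F ∘ (outside ∷_)) S)
      ≈⟨ +-cong (sumL-allSubsets (F ∘ (inside ∷_))) (sumL-allSubsets (F ∘ (outside ∷_))) ⟩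
    Σˢ (F ∘ (inside ∷_)) + Σˢ (F ∘ (outside ∷_))
      ∎
    where
      S : List (Subset m)
      S = allSubsets m

  nonempty-outside : ∀ {m} (I : Subset m) → does (nonempty? (outside ∷ I)) ≡ does (nonempty? I)
  nonempty-outside I = does-⇔
    (mk⇔ (λ { (suc j , there j∈I) → j , j∈I }) (λ (j , j∈I) → suc j , there j∈I))
    (nonempty? (outside ∷ I)) (nonempty? I)

  signed-sum : ∀ {m} (H : Subset m → Carrier) →
    Σˢ (λ I → if does (nonempty? I) then negOnePow R (∣ I ∣ ∸ 1) * H I else 0#)
      ≈ H ⊥ - Σˢ (λ I → negOnePow R ∣ I ∣ * H I)
  signed-sum {zero}  H = solve 1 (λ h → con (+ 0) := h :- con (+ 1) :* h) refl (H [])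
  signed-sum {suc m} H = begin
    A + Σˢ (λ I → if does (nonempty? (outside ∷ I)) then S I else 0#)
      ≈⟨ +-congˡ (Σˢ-cong λ I → reflexive (cong (λ β → if β then S I else 0#) (nonempty-outside I))) ⟩
    A + Σˢ (λ I → if does (nonempty? I) then S I else 0#)
      ≈⟨ +-congˡ (signed-sum (H ∘ (outside ∷_))) ⟩
    A + (H ⊥ - B)
      ≈⟨ solve 3 (λ a h b → a :+ (h :- b) := h :- (:- a :+ b)) refl A (H ⊥) B ⟩
    H ⊥ - (- A + B)
      ≈⟨ +-congˡ (-‿cong (+-congʳ negated-A)) ⟨
    H ⊥ - (Σˢ (λ I → - negOnePow R ∣ I ∣ * H (inside ∷ I)) + B)
      ∎
    where
      S : Subset m → Carrier
      S I = negOnePow R (∣ I ∣ ∸ 1) * H (outside ∷ I)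
      H′ : Bool → Subset m → Carrier
      H′ β I = negOnePow R ∣ I ∣ * H (β ∷ I)
      A B : Carrier
      A = Σˢ (H′ inside)
      B = Σˢ (H′ outside)
      negated-A : Σˢ (λ I → - negOnePow R ∣ I ∣ * H (inside ∷ I)) ≈ - A
      negated-A = sym (trans (Σˢ-homo +-magma +-magma -_ (λ u v → sym (⁻¹-∙-comm u v)) (H′ inside))
                             (Σˢ-cong λ I → -‿distribˡ-* (negOnePow R ∣ I ∣) (H (inside ∷ I))))

module RightHandSide {c ℓ} (R : CommutativeRing c ℓ) {n : ℕ} (x y : Fin (suc (suc n)) → CommutativeRing.Carrier R) where
  open CommutativeRing R hiding (zero)
  open Moments R
  open FinSums R using (Σᶠ-lookup)
  open SubsetSum using (Σˢ; Σˢ-cong)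
  open SubsetSum ⊞-magma using () renaming (Σˢ to Σᴹ; Σˢ-cong to Σᴹ-cong)
  open RingSubsetSums R using (sumL-filter; sumL-allSubsets)

  shift-product : ∀ {m} (dx dy : Carrier) (f g : Fin m → Carrier) → Subset m → Carrier
  shift-product dx dy f g I = Πᶠ R (λ j → if vlookup I j then dx * g j + f j * dy else 1#)

  -- Shifting (P, Q) by (dx, dy) lowers the weight of the pair (f j , g j) by dx · g j + f j · dy
  -- (step-shift); expanding over the set I of lowered weights gives the left-hand side.
  expansion : ∀ {m} P Q dx dy (f g : Fin m → Carrier) →
    Σᴹ (λ I → (negOnePow R ∣ I ∣ * shift-product dx dy f g I) ⊡ moments P Q (complPairs R x y I f g))
      ≈ᴹ moments (P - dx) (Q - dy) (tabulate (λ j → f j , g j))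
  expansion {zero}  P Q dx dy f g = ≈ᴹ-trans (⊡-cong (*-identityˡ 1#) ≈ᴹ-refl) (⊡-identityˡ _)
  expansion {suc m} P Q dx dy f g = begin
    Σᴹ (λ I → (- sign I * (c₀ * Π′ I)) ⊡ M I) ⊞ Σᴹ (λ I → (sign I * (1# * Π′ I)) ⊡ step P Q f₀ g₀ (M I))
      ≈⟨ ⊞-cong (Σᴹ-cong λ I → ≈ᴹ-trans (⊡-cong (sign-swap (sign I) (Π′ I)) ≈ᴹ-refl) (⊡-assoc _ _ _))
                (Σᴹ-cong λ I → ≈ᴹ-trans (⊡-cong (*-congˡ (*-identityˡ _)) ≈ᴹ-refl) (≈ᴹ-sym (step-⊡ P Q f₀ g₀ _ (M I)))) ⟩
    Σᴹ (λ I → (- c₀) ⊡ G I) ⊞ Σᴹ (λ I → step P Q f₀ g₀ (G I))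
      ≈⟨ ⊞-cong (Σˢ-homo ⊞-magma ⊞-magma ((- c₀) ⊡_) (⊡-distribˡ (- c₀)) G)
                (Σˢ-homo ⊞-magma ⊞-magma (step P Q f₀ g₀) (step-⊞ P Q f₀ g₀) G) ⟨
    (- c₀) ⊡ Σᴹ G ⊞ step P Q f₀ g₀ (Σᴹ G)
      ≈⟨ ⊞-cong (⊡-cong refl IH) (step-cong P Q f₀ g₀ IH) ⟩
    (- c₀) ⊡ T ⊞ step P Q f₀ g₀ T
      ≈⟨ step-shift P Q dx dy f₀ g₀ T ⟨
    step (P - dx) (Q - dy) f₀ g₀ T
      ∎
    where
      open import Relation.Binary.Reasoning.Setoid ≈ᴹ-setoid
      open IntegerCoefficients R using (solve; _:=_; _:*_; :-_)
      f₀ g₀ c₀ : Carrier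
      f₀ = f zero
      g₀ = g zero
      c₀ = dx * g₀ + f₀ * dy
      sign Π′ : Subset m → Carrier
      sign I = negOnePow R ∣ I ∣
      Π′ = shift-product dx dy (f ∘ suc) (g ∘ suc)
      M G : Subset m → Moments
      M I = moments P Q (complPairs R x y I (f ∘ suc) (g ∘ suc))
      G I = (sign I * Π′ I) ⊡ M I
      T : Moments
      T = moments (P - dx) (Q - dy) (tabulate (λ j → f (suc j) , g (suc j)))
      IH : Σᴹ G ≈ᴹ T
      IH = expansion P Q dx dy (f ∘ suc) (g ∘ suc)
      sign-swap : ∀ s p → - s * (c₀ * p) ≈ - c₀ * (s * p)
      sign-swap s p = solve 3 (λ s p c → :- s :* (c :* p) := :- c :* (s :* p)) refl s p c₀

  inside+outside : ∀ {m} (h : Carrier × Carrier → Carrier) (I : Subset m) (f g : Fin m → Carrier) →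
    Σᶠ R (λ j → if vlookup I j then h (f j , g j) else 0#) + sumL R (map h (complPairs R x y I f g))
      ≈ Σᶠ R (λ j → h (f j , g j))
  inside+outside h []            f g = +-identityˡ 0#
  inside+outside h (inside ∷ I)  f g = trans (+-assoc _ _ _) (+-congˡ (inside+outside h I (f ∘ suc) (g ∘ suc)))
  inside+outside h (outside ∷ I) f g =
    trans (+-congʳ (+-identityˡ _)) (trans (x∙yz≈y∙xz _ _ _) (+-congˡ (inside+outside h I (f ∘ suc) (g ∘ suc))))
    where open import Algebra.Properties.CommutativeSemigroup +-commutativeSemigroup using (x∙yz≈y∙xz)

  shift-product-⊥ : ∀ {m} dx dy (f g : Fin m → Carrier) → shift-product dx dy f g ⊥ ≈ 1#
  shift-product-⊥ {zero}  dx dy f g = refl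
  shift-product-⊥ {suc m} dx dy f g = trans (*-identityˡ _) (shift-product-⊥ dx dy (f ∘ suc) (g ∘ suc))

  complPairs-⊥ : ∀ {m} (f g : Fin m → Carrier) → complPairs R x y ⊥ f g ≡ tabulate (λ j → f j , g j)
  complPairs-⊥ {zero}  f g = ≡-refl
  complPairs-⊥ {suc m} f g = cong ((f zero , g zero) ∷_) (complPairs-⊥ (f ∘ suc) (g ∘ suc))

  x₀ y₀ X Y : Carrier
  x₀ = x zero
  y₀ = y zero
  X = Σᶠ R x
  Y = Σᶠ R y

  tail : List (Carrier × Carrier)
  tail = tabulate (λ j → x (suc j) , y (suc j))

  unsigned-term : Subset (suc n) → Carrier
  unsigned-term I = shift-product x₀ y₀ (x ∘ suc) (y ∘ suc) I * Φ X Y (rest R x y I)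

  φ-merged : ∀ I → φ R (argX R x y I) (argY R x y I) ≈ Φ X Y (rest R x y I)
  φ-merged I = begin
    φ R (argX R x y I) (argY R x y I)      ≈⟨ GenericPoint.φ≈Φ R (argX R x y I) (argY R x y I) ⟩
    Φ X′ Y′ (tabulate (lookup L))          ≡⟨ cong (Φ X′ Y′) (tabulate-lookup L) ⟩
    Φ X′ Y′ L                              ≈⟨ Φ-cong R L (merged-sum proj₁) (merged-sum proj₂) ⟩
    Φ X Y L                                ∎
    where
      open import Relation.Binary.Reasoning.Setoid setoid
      L : List (Carrier × Carrier)
      L = rest R x y I
      X′ Y′ : Carrier
      X′ = Σᶠ R (argX R x y I)
      Y′ = Σᶠ R (argY R x y I)
      merged-sum : ∀ h → h (x₀ , y₀) + Σᶠ R (λ j → if vlookup I j then h (x (suc j) , y (suc j)) else 0#)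
                           + Σᶠ R (λ j → h (lookup L j))
                         ≈ Σᶠ R (λ j → h (x j , y j))
      merged-sum h = begin
        h (x₀ , y₀) + Σ-inside + Σᶠ R (λ j → h (lookup L j))   ≡⟨ cong (_+_ (h (x₀ , y₀) + Σ-inside)) (Σᶠ-lookup h L) ⟩
        h (x₀ , y₀) + Σ-inside + sumL R (map h L)             ≈⟨ +-assoc _ _ _ ⟩
        h (x₀ , y₀) + (Σ-inside + sumL R (map h L))           ≈⟨ +-congˡ (inside+outside h I (x ∘ suc) (y ∘ suc)) ⟩
        Σᶠ R (λ j → h (x j , y j))                            ∎
        where
          Σ-inside : Carrier
          Σ-inside = Σᶠ R (λ j → if vlookup I j then h (x (suc j) , y (suc j)) else 0#)

  term-merged : ∀ I → term R x y I ≈ negOnePow R (∣ I ∣ ∸ 1) * unsigned-term I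
  term-merged I = *-congˡ (*-congˡ (φ-merged I))

  unsigned-term-⊥ : unsigned-term ⊥ ≈ φ R x y
  unsigned-term-⊥ = begin
    shift-product x₀ y₀ (x ∘ suc) (y ∘ suc) ⊥ * Φ X Y (rest R x y ⊥)
      ≡⟨ cong (λ L → shift-product x₀ y₀ (x ∘ suc) (y ∘ suc) ⊥ * Φ X Y L) (complPairs-⊥ (x ∘ suc) (y ∘ suc)) ⟩
    shift-product x₀ y₀ (x ∘ suc) (y ∘ suc) ⊥ * Φ X Y tail
      ≈⟨ trans (*-congʳ (shift-product-⊥ x₀ y₀ (x ∘ suc) (y ∘ suc))) (*-identityˡ _) ⟩
    Φ X Y tail
      ≈⟨ GenericPoint.φ≈Φ R x y ⟨
    φ R x y
      ∎
    where open import Relation.Binary.Reasoning.Setoid setoid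

  alternating-sum≈0 : Σˢ +-magma (λ I → negOnePow R ∣ I ∣ * unsigned-term I) ≈ 0#
  alternating-sum≈0 = begin
    Σˢ +-magma (λ I → negOnePow R ∣ I ∣ * unsigned-term I)
      ≈⟨ Σˢ-cong +-magma {G = Φᴹ ∘ F} (λ I → trans (sym (*-assoc _ _ _)) (sym (Φᴹ-⊡ _ (moments X Y (rest R x y I))))) ⟩
    Σˢ +-magma (Φᴹ ∘ F)                           ≈⟨ Σˢ-homo ⊞-magma +-magma Φᴹ Φᴹ-⊞ F ⟨
    Φᴹ (Σᴹ F)                                     ≈⟨ Φᴹ-cong (expansion X Y x₀ y₀ (x ∘ suc) (y ∘ suc)) ⟩
    Φ (X - x₀) (Y - y₀) tail                      ≈⟨ Φ-cong R tail (cancel x₀ (Σᶠ R (x ∘ suc))) (cancel y₀ (Σᶠ R (y ∘ suc))) ⟩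
    Φ (Σᶠ R (x ∘ suc)) (Σᶠ R (y ∘ suc)) tail      ≈⟨ GenericPoint.Φ-self≈0 R (x ∘ suc) (y ∘ suc) ⟩
    0#                                            ∎
    where
      open import Relation.Binary.Reasoning.Setoid setoid
      open IntegerCoefficients R using (solve; _:=_; _:+_; _:-_)
      F : Subset (suc n) → Moments
      F I = (negOnePow R ∣ I ∣ * shift-product x₀ y₀ (x ∘ suc) (y ∘ suc) I) ⊡ moments X Y (rest R x y I)
      cancel : ∀ a s → a + s - a ≈ s
      cancel = solve 2 (λ a s → a :+ s :- a := s) refl

  rhs-as-Σˢ : rhs R x y ≈ Σˢ +-magma (λ I → if does (nonempty? I) then term R x y I else 0#)
  rhs-as-Σˢ = trans (sumL-filter nonempty? (term R x y) (allSubsets (suc n)))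
                    (sumL-allSubsets (λ I → if does (nonempty? I) then term R x y I else 0#))

theorem3p1 : ∀ {c ℓ} (R : CommutativeRing c ℓ) (n : ℕ)
               (x y : Fin (suc (suc n)) → CommutativeRing.Carrier R) →
               CommutativeRing._≈_ R (φ R x y) (rhs R x y)
theorem3p1 R n x y = begin
  φ R x y                                             ≈⟨ unsigned-term-⊥ ⟨
  unsigned-term ⊥                                     ≈⟨ x≈x-0 (unsigned-term ⊥) ⟩
  unsigned-term ⊥ - 0#                                ≈⟨ +-congˡ (-‿cong alternating-sum≈0) ⟨
  unsigned-term ⊥ - Σˢ +-magma (λ I → negOnePow R ∣ I ∣ * unsigned-term I)
    ≈⟨ signed-sum unsigned-term ⟨
  Σˢ +-magma (λ I → if does (nonempty? I) then negOnePow R (∣ I ∣ ∸ 1) * unsigned-term I else 0#)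
    ≈⟨ Σˢ-cong +-magma (λ I → if-congˡ (does (nonempty? I)) (term-merged I)) ⟨
  Σˢ +-magma (λ I → if does (nonempty? I) then term R x y I else 0#)
    ≈⟨ rhs-as-Σˢ ⟨
  rhs R x y
    ∎
  where
    open CommutativeRing R hiding (zero)
    open RightHandSide R x y
    open RingSubsetSums R using (signed-sum)
    open SubsetSum using (Σˢ; Σˢ-cong)
    open import Algebra.Properties.Ring ring using (-0#≈0#)
    open import Relation.Binary.Reasoning.Setoid setoid
    x≈x-0 : ∀ a → a ≈ a - 0#
    x≈x-0 a = sym (trans (+-congˡ -0#≈0#) (+-identityʳ a))
    if-congˡ : ∀ β {a b} → a ≈ b → (if β then a else 0#) ≈ (if β then b else 0#)
    if-congˡ true  a≈b = a≈b
    if-congˡ false a≈b = refl
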